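{- For all integers $n\ge 0$, \[ a_{2,4}(27n)\equiv a_{2,4}(3n) \pmod 3. \]
   Context: For positive integers $r,s$, $a_{r,s}(n)$ denotes the number of multicolored partitions of $n$ in which each even part may appear in one of $r$ colors and each odd part may appear in one of $s$ colors (copies of the same part size in different colors are distinct), with $a_{r,s}(0)=1$. Equivalently, for $|q|<1$, $\sum_{n\ge0}a_{r,s}(n)q^n = f_2^{s-r}/f_1^{s}$, where $f_m=\prod_{i\ge1}(1-q^{mi})$. In particular $\sum_{n\ge0}a_{2,4}(n)q^n=f_2^2/f_1^4$. -}

module Defs where

open import Data.Nat using (ℕ; zero; suc; _+_; _*_; _∸_; _≤ᵇ_)
open import Data.Nat.Base using (_%_)
open import Data.Bool using (if_then_else_)
open import Data.List using (List; []; _∷_; map; upTo; concatMap; replicate)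
open import Data.Nat.ListAction using (sum)

colours : ℕ → ℕ → ℕ → ℕ
colours r s k = if (k % 2 ≤ᵇ 0) then r else s

-- List of "part types" (part size, one entry per colour) with part sizes 1..n.
-- A part of size k appears (colours r s k) times, once for each colour.
partTypes : ℕ → ℕ → ℕ → List ℕ
partTypes r s n = concatMap (λ k → replicate (colours r s (suc k)) (suc k)) (upTo n)

-- countParts n ts : number of ways to write n = Σ_j m_j * t_j  (m_j ≥ 0),
-- i.e. number of multisets of part types from ts summing to n.
-- (All part sizes in ts are ≥ 1, so m ≤ n suffices for the multiplicity.)
countParts : ℕ → List ℕ → ℕ
countParts n [] = if (n ≤ᵇ 0) then 1 else 0
countParts n (t ∷ ts) =
  sum (map (λ m → if (m * t ≤ᵇ n) then countParts (n ∸ m * t) ts else 0) (upTo (suc n)))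

a : ℕ → ℕ → ℕ → ℕ
a r s n = countParts n (partTypes r s n)

{-# OPTIONS --safe #-}
-- Reduce the generating functions modulo 3, i.e. work with power series over 𝔽₃, and write
-- f_m = ∏_k (1 - q^(mk)).  Frobenius (X³ = X(q³)) gives f₁³ = f₃, so ∑ a(n) qⁿ = f₂²/f₁⁴ becomes
-- P = ψ/f₃ with ψ = ∑ q^(j(j+1)/2) = f₂²/f₁.  The 3-dissection ψ = A(q³) + q ψ(q⁹), where
-- A = f(q², q) = f₂f₃²/(f₁f₆), shows that G = U₃P (the coefficients of q^(3n)) equals A/f₁.
-- From the product forms, Aψ = f₁f₃, so Gψ = f₃ and ψ · U₃G = U₃(ψ³G) = U₃(f₃ψ²) = f₁A²; hence
-- f₃ · U₃G = A³ = A(q³) and U₃U₃G = A/f₁ = G, that is a(27n) ≡ a(3n).  The product forms of ψ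
-- and A are instances of the Jacobi triple product, obtained from the finite q-binomial theorem.
module Submission where

open import Data.Nat.Base using (ℕ)

module Field3 where
  open import Data.Nat.Base using (zero; suc; _+_; _%_)
  open import Data.Nat.Properties using (+-comm)
  open import Data.Nat.DivMod using ([m+n]%n≡m%n)
  open import Relation.Binary.PropositionalEquality using (_≡_; refl; sym; trans; cong; module ≡-Reasoning)

  data 𝔽₃ : Set where
    0₃ 1₃ 2₃ : 𝔽₃

  infixl 6 _+₃_
  infixl 7 _*₃_
  infix 8 -₃_

  _+₃_ : 𝔽₃ → 𝔽₃ → 𝔽₃
  0₃ +₃ y  = y
  1₃ +₃ 0₃ = 1₃
  1₃ +₃ 1₃ = 2₃
  1₃ +₃ 2₃ = 0₃
  2₃ +₃ 0₃ = 2₃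
  2₃ +₃ 1₃ = 0₃
  2₃ +₃ 2₃ = 1₃

  _*₃_ : 𝔽₃ → 𝔽₃ → 𝔽₃
  0₃ *₃ y  = 0₃
  1₃ *₃ y  = y
  2₃ *₃ 0₃ = 0₃
  2₃ *₃ 1₃ = 2₃
  2₃ *₃ 2₃ = 1₃

  -₃_ : 𝔽₃ → 𝔽₃
  -₃ 0₃ = 0₃
  -₃ 1₃ = 2₃
  -₃ 2₃ = 1₃

  +₃-assoc : ∀ x y z → (x +₃ y) +₃ z ≡ x +₃ (y +₃ z)
  +₃-assoc 0₃ y z = refl
  +₃-assoc 1₃ 0₃ z = refl
  +₃-assoc 1₃ 1₃ 0₃ = refl
  +₃-assoc 1₃ 1₃ 1₃ = refl
  +₃-assoc 1₃ 1₃ 2₃ = refl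
  +₃-assoc 1₃ 2₃ 0₃ = refl
  +₃-assoc 1₃ 2₃ 1₃ = refl
  +₃-assoc 1₃ 2₃ 2₃ = refl
  +₃-assoc 2₃ 0₃ z = refl
  +₃-assoc 2₃ 1₃ 0₃ = refl
  +₃-assoc 2₃ 1₃ 1₃ = refl
  +₃-assoc 2₃ 1₃ 2₃ = refl
  +₃-assoc 2₃ 2₃ 0₃ = refl
  +₃-assoc 2₃ 2₃ 1₃ = refl
  +₃-assoc 2₃ 2₃ 2₃ = refl

  +₃-comm : ∀ x y → x +₃ y ≡ y +₃ x
  +₃-comm 0₃ 0₃ = refl
  +₃-comm 0₃ 1₃ = refl
  +₃-comm 0₃ 2₃ = refl
  +₃-comm 1₃ 0₃ = refl
  +₃-comm 1₃ 1₃ = refl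
  +₃-comm 1₃ 2₃ = refl
  +₃-comm 2₃ 0₃ = refl
  +₃-comm 2₃ 1₃ = refl
  +₃-comm 2₃ 2₃ = refl

  +₃-identityʳ : ∀ x → x +₃ 0₃ ≡ x
  +₃-identityʳ 0₃ = refl
  +₃-identityʳ 1₃ = refl
  +₃-identityʳ 2₃ = refl

  +₃-inverseʳ : ∀ x → x +₃ -₃ x ≡ 0₃
  +₃-inverseʳ 0₃ = refl
  +₃-inverseʳ 1₃ = refl
  +₃-inverseʳ 2₃ = refl

  *₃-comm : ∀ x y → x *₃ y ≡ y *₃ x
  *₃-comm 0₃ 0₃ = refl
  *₃-comm 0₃ 1₃ = refl
  *₃-comm 0₃ 2₃ = refl
  *₃-comm 1₃ 0₃ = refl
  *₃-comm 1₃ 1₃ = refl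
  *₃-comm 1₃ 2₃ = refl
  *₃-comm 2₃ 0₃ = refl
  *₃-comm 2₃ 1₃ = refl
  *₃-comm 2₃ 2₃ = refl

  *₃-assoc : ∀ x y z → (x *₃ y) *₃ z ≡ x *₃ (y *₃ z)
  *₃-assoc 0₃ y z = refl
  *₃-assoc 1₃ y z = refl
  *₃-assoc 2₃ 0₃ z = refl
  *₃-assoc 2₃ 1₃ z = refl
  *₃-assoc 2₃ 2₃ 0₃ = refl
  *₃-assoc 2₃ 2₃ 1₃ = refl
  *₃-assoc 2₃ 2₃ 2₃ = refl

  *₃-zeroʳ : ∀ x → x *₃ 0₃ ≡ 0₃
  *₃-zeroʳ 0₃ = refl
  *₃-zeroʳ 1₃ = refl
  *₃-zeroʳ 2₃ = refl

  *₃-distribˡ-+₃ : ∀ x y z → x *₃ (y +₃ z) ≡ x *₃ y +₃ x *₃ z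
  *₃-distribˡ-+₃ 0₃ y z = refl
  *₃-distribˡ-+₃ 1₃ y z = refl
  *₃-distribˡ-+₃ 2₃ 0₃ z = refl
  *₃-distribˡ-+₃ 2₃ 1₃ 0₃ = refl
  *₃-distribˡ-+₃ 2₃ 1₃ 1₃ = refl
  *₃-distribˡ-+₃ 2₃ 1₃ 2₃ = refl
  *₃-distribˡ-+₃ 2₃ 2₃ 0₃ = refl
  *₃-distribˡ-+₃ 2₃ 2₃ 1₃ = refl
  *₃-distribˡ-+₃ 2₃ 2₃ 2₃ = refl

  *₃-distribʳ-+₃ : ∀ x y z → (y +₃ z) *₃ x ≡ y *₃ x +₃ z *₃ x
  *₃-distribʳ-+₃ x y z rewrite *₃-comm (y +₃ z) x | *₃-comm y x | *₃-comm z x = *₃-distribˡ-+₃ x y z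

  x*x*x≡x : ∀ x → x *₃ x *₃ x ≡ x
  x*x*x≡x 0₃ = refl
  x*x*x≡x 1₃ = refl
  x*x*x≡x 2₃ = refl

  +₃-cancelʳ : ∀ {x y} z → x +₃ z ≡ y +₃ z → x ≡ y
  +₃-cancelʳ {x} {y} z eq = begin
    x                   ≡⟨ sym (+₃-identityʳ x) ⟩
    x +₃ 0₃             ≡⟨ cong (x +₃_) (sym (+₃-inverseʳ z)) ⟩
    x +₃ (z +₃ -₃ z)    ≡⟨ sym (+₃-assoc x z (-₃ z)) ⟩
    (x +₃ z) +₃ -₃ z    ≡⟨ cong (_+₃ -₃ z) eq ⟩
    (y +₃ z) +₃ -₃ z    ≡⟨ +₃-assoc y z (-₃ z) ⟩
    y +₃ (z +₃ -₃ z)    ≡⟨ cong (y +₃_) (+₃-inverseʳ z) ⟩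
    y +₃ 0₃             ≡⟨ +₃-identityʳ y ⟩
    y                   ∎
    where open ≡-Reasoning

  reduce₃ : ℕ → 𝔽₃
  reduce₃ zero    = 0₃
  reduce₃ (suc n) = 1₃ +₃ reduce₃ n

  reduce₃-+ : ∀ m n → reduce₃ (m + n) ≡ reduce₃ m +₃ reduce₃ n
  reduce₃-+ zero    n = refl
  reduce₃-+ (suc m) n = trans (cong (1₃ +₃_) (reduce₃-+ m n)) (sym (+₃-assoc 1₃ (reduce₃ m) (reduce₃ n)))

  toℕ₃ : 𝔽₃ → ℕ
  toℕ₃ 0₃ = 0
  toℕ₃ 1₃ = 1
  toℕ₃ 2₃ = 2

  %3≡toℕ₃∘reduce₃ : ∀ n → n % 3 ≡ toℕ₃ (reduce₃ n)
  %3≡toℕ₃∘reduce₃ 0                   = refl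
  %3≡toℕ₃∘reduce₃ 1                   = refl
  %3≡toℕ₃∘reduce₃ 2                   = refl
  %3≡toℕ₃∘reduce₃ (suc (suc (suc n))) = begin
    (3 + n) % 3                         ≡⟨ cong (_% 3) (+-comm 3 n) ⟩
    (n + 3) % 3                         ≡⟨ [m+n]%n≡m%n n 3 ⟩
    n % 3                               ≡⟨ %3≡toℕ₃∘reduce₃ n ⟩
    toℕ₃ (reduce₃ n)                    ≡⟨ cong toℕ₃ (sym (1+1+1+ (reduce₃ n))) ⟩
    toℕ₃ (1₃ +₃ (1₃ +₃ (1₃ +₃ reduce₃ n))) ∎
    where
    open ≡-Reasoning
    1+1+1+ : ∀ x → 1₃ +₃ (1₃ +₃ (1₃ +₃ x)) ≡ x
    1+1+1+ 0₃ = refl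
    1+1+1+ 1₃ = refl
    1+1+1+ 2₃ = refl


module PowerSeries where
  open Field3 public
  open import Data.Nat.Base using (ℕ; zero; suc)
  open import Data.Product.Base using (_,_)
  open import Relation.Binary.PropositionalEquality
    using (_≡_; refl; sym; trans; cong; cong₂; module ≡-Reasoning)
  open import Relation.Binary.Structures using (IsEquivalence)
  import Relation.Binary.Reasoning.Setoid
  open import Algebra.Bundles using (CommutativeRing; RawRing)
  open import Data.Maybe.Base using (Maybe; just; nothing)

  Series : Set
  Series = ℕ → 𝔽₃

  infix 4 _≈_
  _≈_ : Series → Series → Set
  X ≈ Y = ∀ n → X n ≡ Y n

  ≈-refl : ∀ {X} → X ≈ X
  ≈-refl n = refl

  ≈-reflexive : ∀ {X Y} → X ≡ Y → X ≈ Y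
  ≈-reflexive refl = ≈-refl

  ≈-sym : ∀ {X Y} → X ≈ Y → Y ≈ X
  ≈-sym p n = sym (p n)

  ≈-trans : ∀ {X Y Z} → X ≈ Y → Y ≈ Z → X ≈ Z
  ≈-trans p q n = trans (p n) (q n)

  ≈-isEquivalence : IsEquivalence _≈_
  ≈-isEquivalence = record { refl = ≈-refl ; sym = ≈-sym ; trans = ≈-trans }

  const : 𝔽₃ → Series
  const c zero    = c
  const c (suc n) = 0₃

  0# 1# : Series
  0# n = 0₃
  1# = const 1₃

  infixl 6 _+_ _-_
  infixl 7 _*_ _·_
  infix  8 -_

  _+_ : Series → Series → Series
  (X + Y) n = X n +₃ Y n

  -_ : Series → Series
  (- X) n = -₃ X n

  _-_ : Series → Series → Series
  X - Y = X + - Y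

  _·_ : 𝔽₃ → Series → Series
  (c · X) n = c *₃ X n

  shift : Series → Series
  shift X zero    = 0₃
  shift X (suc n) = X n

  tail : Series → Series
  tail X n = X (suc n)

  _*_ : Series → Series → Series
  (X * Y) zero    = X 0 *₃ Y 0
  (X * Y) (suc n) = X 0 *₃ Y (suc n) +₃ (tail X * Y) n

  *-unfold : ∀ X Y → X * Y ≈ X 0 · Y + shift (tail X * Y)
  *-unfold X Y zero    = sym (+₃-identityʳ _)
  *-unfold X Y (suc n) = refl

  +-cong : ∀ {X X′ Y Y′} → X ≈ X′ → Y ≈ Y′ → X + Y ≈ X′ + Y′
  +-cong p q n = cong₂ _+₃_ (p n) (q n)

  -‿cong : ∀ {X X′} → X ≈ X′ → - X ≈ - X′
  -‿cong p n = cong -₃_ (p n)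

  *-cong : ∀ {X X′ Y Y′} → X ≈ X′ → Y ≈ Y′ → X * Y ≈ X′ * Y′
  *-cong p q zero    = cong₂ _*₃_ (p 0) (q 0)
  *-cong p q (suc n) = cong₂ _+₃_ (cong₂ _*₃_ (p 0) (q (suc n))) (*-cong (λ m → p (suc m)) q n)

  +-assoc : ∀ X Y Z → (X + Y) + Z ≈ X + (Y + Z)
  +-assoc X Y Z n = +₃-assoc (X n) (Y n) (Z n)

  +-comm : ∀ X Y → X + Y ≈ Y + X
  +-comm X Y n = +₃-comm (X n) (Y n)

  +-identityˡ : ∀ X → 0# + X ≈ X
  +-identityˡ X n = refl

  +-identityʳ : ∀ X → X + 0# ≈ X
  +-identityʳ X n = +₃-identityʳ (X n)

  +-inverseʳ : ∀ X → X + - X ≈ 0#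
  +-inverseʳ X n = +₃-inverseʳ (X n)

  +-inverseˡ : ∀ X → - X + X ≈ 0#
  +-inverseˡ X n = trans (+₃-comm (-₃ X n) (X n)) (+₃-inverseʳ (X n))

  private
    +₃-interchange : ∀ a b c d → (a +₃ b) +₃ (c +₃ d) ≡ (a +₃ c) +₃ (b +₃ d)
    +₃-interchange a b c d = begin
      (a +₃ b) +₃ (c +₃ d)  ≡⟨ +₃-assoc a b (c +₃ d) ⟩
      a +₃ (b +₃ (c +₃ d))  ≡⟨ cong (a +₃_) (sym (+₃-assoc b c d)) ⟩
      a +₃ ((b +₃ c) +₃ d)  ≡⟨ cong (λ w → a +₃ (w +₃ d)) (+₃-comm b c) ⟩
      a +₃ ((c +₃ b) +₃ d)  ≡⟨ cong (a +₃_) (+₃-assoc c b d) ⟩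
      a +₃ (c +₃ (b +₃ d))  ≡⟨ sym (+₃-assoc a c (b +₃ d)) ⟩
      (a +₃ c) +₃ (b +₃ d)  ∎
      where open ≡-Reasoning

  *-zeroˡ : ∀ X → 0# * X ≈ 0#
  *-zeroˡ X zero    = refl
  *-zeroˡ X (suc n) = *-zeroˡ X n

  *-identityˡ : ∀ X → 1# * X ≈ X
  *-identityˡ X zero    = refl
  *-identityˡ X (suc n) = trans (cong (X (suc n) +₃_) (*-zeroˡ X n)) (+₃-identityʳ _)

  *-distribʳ-+ : ∀ Z X Y → (X + Y) * Z ≈ X * Z + Y * Z
  *-distribʳ-+ Z X Y zero    = *₃-distribʳ-+₃ (Z 0) (X 0) (Y 0)
  *-distribʳ-+ Z X Y (suc n) =
    trans (cong₂ _+₃_ (*₃-distribʳ-+₃ (Z (suc n)) (X 0) (Y 0)) (*-distribʳ-+ Z (tail X) (tail Y) n))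
          (+₃-interchange (X 0 *₃ Z (suc n)) (Y 0 *₃ Z (suc n)) ((tail X * Z) n) ((tail Y * Z) n))

  *-distribˡ-+ : ∀ X Y Z → X * (Y + Z) ≈ X * Y + X * Z
  *-distribˡ-+ X Y Z zero    = *₃-distribˡ-+₃ (X 0) (Y 0) (Z 0)
  *-distribˡ-+ X Y Z (suc n) =
    trans (cong₂ _+₃_ (*₃-distribˡ-+₃ (X 0) (Y (suc n)) (Z (suc n))) (*-distribˡ-+ (tail X) Y Z n))
          (+₃-interchange (X 0 *₃ Y (suc n)) (X 0 *₃ Z (suc n)) ((tail X * Y) n) ((tail X * Z) n))

  -- Both sides are unfolded twice, so that the two cross terms X₀Yₙ₊₂ and Y₀Xₙ₊₂ can be swapped.
  *-comm : ∀ X Y → X * Y ≈ Y * X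
  *-comm X Y zero          = *₃-comm (X 0) (Y 0)
  *-comm X Y (suc zero)    =
    trans (+₃-comm (X 0 *₃ Y 1) (X 1 *₃ Y 0)) (cong₂ _+₃_ (*₃-comm (X 1) (Y 0)) (*₃-comm (X 0) (Y 1)))
  *-comm X Y (suc (suc n)) = begin
    X 0 *₃ Y (2 +ℕ n) +₃ (tail X * Y) (suc n)
      ≡⟨ cong (X 0 *₃ Y (2 +ℕ n) +₃_) (*-comm (tail X) Y (suc n)) ⟩
    X 0 *₃ Y (2 +ℕ n) +₃ (Y 0 *₃ X (2 +ℕ n) +₃ (tail Y * tail X) n)
      ≡⟨ cong (λ w → X 0 *₃ Y (2 +ℕ n) +₃ (Y 0 *₃ X (2 +ℕ n) +₃ w)) (*-comm (tail Y) (tail X) n) ⟩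
    X 0 *₃ Y (2 +ℕ n) +₃ (Y 0 *₃ X (2 +ℕ n) +₃ (tail X * tail Y) n)
      ≡⟨ sym (+₃-assoc (X 0 *₃ Y (2 +ℕ n)) (Y 0 *₃ X (2 +ℕ n)) _) ⟩
    X 0 *₃ Y (2 +ℕ n) +₃ Y 0 *₃ X (2 +ℕ n) +₃ (tail X * tail Y) n
      ≡⟨ cong (_+₃ (tail X * tail Y) n) (+₃-comm (X 0 *₃ Y (2 +ℕ n)) (Y 0 *₃ X (2 +ℕ n))) ⟩
    Y 0 *₃ X (2 +ℕ n) +₃ X 0 *₃ Y (2 +ℕ n) +₃ (tail X * tail Y) n
      ≡⟨ +₃-assoc (Y 0 *₃ X (2 +ℕ n)) (X 0 *₃ Y (2 +ℕ n)) _ ⟩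
    Y 0 *₃ X (2 +ℕ n) +₃ (X 0 *₃ Y (2 +ℕ n) +₃ (tail X * tail Y) n)
      ≡⟨ cong (Y 0 *₃ X (2 +ℕ n) +₃_) (*-comm X (tail Y) (suc n)) ⟩
    Y 0 *₃ X (2 +ℕ n) +₃ (tail Y * X) (suc n)
      ∎
    where
    open ≡-Reasoning
    open import Data.Nat.Base using () renaming (_+_ to _+ℕ_)

  ·-*-assoc : ∀ c X Y → c · X * Y ≈ c · (X * Y)
  ·-*-assoc c X Y zero    = *₃-assoc c (X 0) (Y 0)
  ·-*-assoc c X Y (suc n) =
    trans (cong₂ _+₃_ (*₃-assoc c (X 0) (Y (suc n))) (·-*-assoc c (tail X) Y n))
          (sym (*₃-distribˡ-+₃ c (X 0 *₃ Y (suc n)) ((tail X * Y) n)))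

  shift-*-assoc : ∀ X Y → shift X * Y ≈ shift (X * Y)
  shift-*-assoc X Y zero    = refl
  shift-*-assoc X Y (suc n) = refl

  *-assoc : ∀ X Y Z → (X * Y) * Z ≈ X * (Y * Z)
  *-assoc X Y Z zero    = *₃-assoc (X 0) (Y 0) (Z 0)
  *-assoc X Y Z (suc n) =
    trans (*-cong (*-unfold X Y) (≈-refl {Z}) (suc n))
      (trans (*-distribʳ-+ Z (X 0 · Y) (shift (tail X * Y)) (suc n))
        (cong₂ _+₃_ (·-*-assoc (X 0) Y Z (suc n)) (*-assoc (tail X) Y Z n)))

  *-identityʳ : ∀ X → X * 1# ≈ X
  *-identityʳ X = ≈-trans (*-comm X 1#) (*-identityˡ X)

  *-zeroʳ : ∀ X → X * 0# ≈ 0#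
  *-zeroʳ X = ≈-trans (*-comm X 0#) (*-zeroˡ X)

  ring : CommutativeRing _ _
  ring = record
    { Carrier = Series ; _≈_ = _≈_ ; _+_ = _+_ ; _*_ = _*_ ; -_ = -_ ; 0# = 0# ; 1# = 1#
    ; isCommutativeRing = record
      { isRing = record
        { +-isAbelianGroup = record
          { isGroup = record
            { isMonoid = record
              { isSemigroup = record
                { isMagma = record { isEquivalence = ≈-isEquivalence ; ∙-cong = +-cong }
                ; assoc = +-assoc }
              ; identity = +-identityˡ , +-identityʳ }
            ; inverse = +-inverseˡ , +-inverseʳ
            ; ⁻¹-cong = -‿cong }
          ; comm = +-comm }
        ; *-cong = *-cong
        ; *-assoc = *-assoc
        ; *-identity = *-identityˡ , *-identityʳ
        ; distrib = *-distribˡ-+ , *-distribʳ-+ }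
      ; *-comm = *-comm }
    }

  module ≈-Reasoning = Relation.Binary.Reasoning.Setoid (CommutativeRing.setoid ring)

  const-*-homo : ∀ x y → const (x *₃ y) ≈ const x * const y
  const-*-homo x y zero    = refl
  const-*-homo x y (suc n) = sym (cong₂ _+₃_ (*₃-zeroʳ x) (*-zeroˡ (const y) n))

  const-≟ : ∀ x y → Maybe (const x ≈ const y)
  const-≟ 0₃ 0₃ = just ≈-refl
  const-≟ 1₃ 1₃ = just ≈-refl
  const-≟ 2₃ 2₃ = just ≈-refl
  const-≟ _  _  = nothing

  -- With coefficients in 𝔽₃ the solver knows that 1 + 1 + 1 = 0.
  module Solver where
    open import Algebra.Solver.Ring.AlmostCommutativeRing
      using (fromCommutativeRing; _-Raw-AlmostCommutative⟶_)

    𝔽₃-rawRing : RawRing _ _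
    𝔽₃-rawRing = record
      { Carrier = 𝔽₃ ; _≈_ = _≡_ ; _+_ = _+₃_ ; _*_ = _*₃_ ; -_ = -₃_ ; 0# = 0₃ ; 1# = 1₃ }

    const-morphism : 𝔽₃-rawRing -Raw-AlmostCommutative⟶ fromCommutativeRing ring
    const-morphism = record
      { ⟦_⟧    = const
      ; +-homo = λ { x y zero → refl ; x y (suc n) → refl }
      ; *-homo = const-*-homo
      ; -‿homo = λ { x zero → refl ; x (suc n) → refl }
      ; 0-homo = λ { zero → refl ; (suc n) → refl }
      ; 1-homo = λ _ → refl }

    open import Algebra.Solver.Ring 𝔽₃-rawRing (fromCommutativeRing ring) const-morphism const-≟ public

module Truncation where
  open PowerSeries public
  open import Data.Nat.Base using (ℕ; zero; suc; _<_; _≤_; z≤n; s≤s)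
  open import Data.Nat.Properties using (≤-refl; ≤-trans; n≤1+n; m<n⇒m<1+n; m≤n⇒m<n∨m≡n)
  open import Data.Sum.Base using ([_,_]′)
  open import Relation.Binary.PropositionalEquality using (_≡_; refl; sym; trans; cong; cong₂)
  open import Relation.Binary.Bundles using (Setoid)
  import Relation.Binary.Reasoning.Setoid

  infix 4 _≈[_]_
  _≈[_]_ : Series → ℕ → Series → Set
  X ≈[ K ] Y = ∀ n → n < K → X n ≡ Y n

  ≈⇒≈[] : ∀ {X Y} K → X ≈ Y → X ≈[ K ] Y
  ≈⇒≈[] K p n _ = p n

  ≈[]⇒≈ : ∀ {X Y} → (∀ K → X ≈[ K ] Y) → X ≈ Y
  ≈[]⇒≈ p n = p (suc n) n ≤-refl

  ≈[]-refl : ∀ {X} K → X ≈[ K ] X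
  ≈[]-refl K n _ = refl

  ≈[]-sym : ∀ {X Y} K → X ≈[ K ] Y → Y ≈[ K ] X
  ≈[]-sym K p n n<K = sym (p n n<K)

  ≈[]-trans : ∀ {X Y Z} K → X ≈[ K ] Y → Y ≈[ K ] Z → X ≈[ K ] Z
  ≈[]-trans K p q n n<K = trans (p n n<K) (q n n<K)

  ≈[]-setoid : ℕ → Setoid _ _
  ≈[]-setoid K = record
    { Carrier = Series ; _≈_ = _≈[ K ]_
    ; isEquivalence = record { refl = ≈[]-refl K ; sym = ≈[]-sym K ; trans = ≈[]-trans K } }

  module ≈[]-Reasoning (K : ℕ) = Relation.Binary.Reasoning.Setoid (≈[]-setoid K)

  ≈[]-weaken : ∀ {X Y K L} → L ≤ K → X ≈[ K ] Y → X ≈[ L ] Y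
  ≈[]-weaken L≤K p n n<L = p n (≤-trans n<L L≤K)

  +-cong-≈[] : ∀ {X X′ Y Y′} K → X ≈[ K ] X′ → Y ≈[ K ] Y′ → X + Y ≈[ K ] X′ + Y′
  +-cong-≈[] K p q n n<K = cong₂ _+₃_ (p n n<K) (q n n<K)

  *-cong-≈[] : ∀ {X X′ Y Y′} K → X ≈[ K ] X′ → Y ≈[ K ] Y′ → X * Y ≈[ K ] X′ * Y′
  *-cong-≈[] K       p q zero    0<K         = cong₂ _*₃_ (p 0 0<K) (q 0 0<K)
  *-cong-≈[] (suc K) p q (suc n) (s≤s n<K) =
    cong₂ _+₃_ (cong₂ _*₃_ (p 0 (s≤s z≤n)) (q (suc n) (s≤s n<K)))
               (*-cong-≈[] K (λ m m<K → p (suc m) (s≤s m<K)) (λ m m<K → q m (m<n⇒m<1+n m<K)) n n<K)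

  1#+-≈[] : ∀ {X} K → X ≈[ K ] 0# → 1# + X ≈[ K ] 1#
  1#+-≈[] K p n n<K = trans (cong (1# n +₃_) (p n n<K)) (+₃-identityʳ (1# n))

  1#--≈[] : ∀ {X} K → X ≈[ K ] 0# → 1# - X ≈[ K ] 1#
  1#--≈[] K p n n<K = trans (cong (λ x → 1# n +₃ -₃ x) (p n n<K)) (+₃-identityʳ (1# n))

  *-≈[]-1# : ∀ {X Y} K → X ≈[ K ] 1# → Y ≈[ K ] 1# → X * Y ≈[ K ] 1#
  *-≈[]-1# K p q = ≈[]-trans K (*-cong-≈[] K p q) (≈⇒≈[] K (*-identityˡ 1#))

  private
    unit-coefficient : ∀ {U X Y} n → U 0 ≡ 1₃ → X ≈[ n ] Y → (U * X) n ≡ (U * Y) n → X n ≡ Y n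
    unit-coefficient {U} {X} {Y} zero    U₀≡1 _   eq =
      trans (cong (_*₃ X 0) (sym U₀≡1)) (trans eq (cong (_*₃ Y 0) U₀≡1))
    unit-coefficient {U} {X} {Y} (suc n) U₀≡1 X≈Y eq =
      trans (cong (_*₃ X (suc n)) (sym U₀≡1))
        (trans (+₃-cancelʳ _ (trans eq (cong (U 0 *₃ Y (suc n) +₃_) tails-agree)))
          (cong (_*₃ Y (suc n)) U₀≡1))
      where
      tails-agree : (tail U * Y) n ≡ (tail U * X) n
      tails-agree = *-cong-≈[] (suc n) (≈[]-refl (suc n)) (≈[]-sym (suc n) X≈Y) n ≤-refl

  *-cancelˡ-≈[] : ∀ {U X Y} K → U 0 ≡ 1₃ → U * X ≈[ K ] U * Y → X ≈[ K ] Y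
  *-cancelˡ-≈[] zero    U₀≡1 eq n ()
  *-cancelˡ-≈[] {U} {X} {Y} (suc K) U₀≡1 eq n (s≤s n≤K) =
    [ X≈[K]Y n , (λ { refl → unit-coefficient K U₀≡1 X≈[K]Y (eq K ≤-refl) }) ]′ (m≤n⇒m<n∨m≡n n≤K)
    where
    X≈[K]Y : X ≈[ K ] Y
    X≈[K]Y = *-cancelˡ-≈[] K U₀≡1 (≈[]-weaken (n≤1+n K) eq)

  *-cancelˡ : ∀ {U X Y} → U 0 ≡ 1₃ → U * X ≈ U * Y → X ≈ Y
  *-cancelˡ U₀≡1 eq = ≈[]⇒≈ (λ K → *-cancelˡ-≈[] K U₀≡1 (≈⇒≈[] K eq))

module Monomials where
  open Truncation public
  open import Data.Nat.Base using (ℕ; zero; suc; _<_; _≤_; s≤s) renaming (_+_ to _+ℕ_; _*_ to _*ℕ_)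
  import Data.Nat.Properties as ℕ
  open import Relation.Binary.PropositionalEquality using (_≡_; refl; sym; cong; module ≡-Reasoning)
  open Solver using (solve; _:=_; _:*_)

  shift-cong : ∀ {X Y} → X ≈ Y → shift X ≈ shift Y
  shift-cong p zero    = refl
  shift-cong p (suc n) = p n

  shift-+ : ∀ X Y → shift (X + Y) ≈ shift X + shift Y
  shift-+ X Y zero    = refl
  shift-+ X Y (suc n) = refl

  shiftBy : ℕ → Series → Series
  shiftBy zero    X = X
  shiftBy (suc k) X = shift (shiftBy k X)

  shiftBy-cong : ∀ k {X Y} → X ≈ Y → shiftBy k X ≈ shiftBy k Y
  shiftBy-cong zero    p = p
  shiftBy-cong (suc k) p = shift-cong (shiftBy-cong k p)

  shiftBy-≈[] : ∀ {X Y} k K → X ≈[ K ] Y → shiftBy k X ≈[ k +ℕ K ] shiftBy k Y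
  shiftBy-≈[] zero    K p = p
  shiftBy-≈[] (suc k) K p zero    _         = refl
  shiftBy-≈[] (suc k) K p (suc n) (s≤s n<K) = shiftBy-≈[] k K p n n<K

  shiftBy-+ : ∀ k X Y → shiftBy k (X + Y) ≈ shiftBy k X + shiftBy k Y
  shiftBy-+ zero    X Y = ≈-refl
  shiftBy-+ (suc k) X Y = ≈-trans (shift-cong (shiftBy-+ k X Y)) (shift-+ (shiftBy k X) (shiftBy k Y))

  shiftBy-0# : ∀ k → shiftBy k 0# ≈ 0#
  shiftBy-0# zero    n       = refl
  shiftBy-0# (suc k) zero    = refl
  shiftBy-0# (suc k) (suc n) = shiftBy-0# k n

  shiftBy-at : ∀ k X n → shiftBy k X (k +ℕ n) ≡ X n
  shiftBy-at zero    X n = refl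
  shiftBy-at (suc k) X n = shiftBy-at k X n

  shiftBy-below : ∀ k X n → n < k → shiftBy k X n ≡ 0₃
  shiftBy-below (suc k) X zero    _         = refl
  shiftBy-below (suc k) X (suc n) (s≤s n<k) = shiftBy-below k X n n<k

  shiftBy-*-assoc : ∀ k X Y → shiftBy k X * Y ≈ shiftBy k (X * Y)
  shiftBy-*-assoc zero    X Y = ≈-refl
  shiftBy-*-assoc (suc k) X Y = ≈-trans (shift-*-assoc (shiftBy k X) Y) (shift-cong (shiftBy-*-assoc k X Y))

  shiftBy-+-shiftBy : ∀ a b X → shiftBy a (shiftBy b X) ≈ shiftBy (a +ℕ b) X
  shiftBy-+-shiftBy zero    b X = ≈-refl
  shiftBy-+-shiftBy (suc a) b X = shift-cong (shiftBy-+-shiftBy a b X)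

  infix 9 q^_
  q^_ : ℕ → Series
  q^ e = shiftBy e 1#

  q^-* : ∀ k X → q^ k * X ≈ shiftBy k X
  q^-* k X = ≈-trans (shiftBy-*-assoc k 1# X) (shiftBy-cong k (*-identityˡ X))

  q^-*-q^ : ∀ a b → q^ a * q^ b ≈ q^ (a +ℕ b)
  q^-*-q^ a b = ≈-trans (q^-* a (q^ b)) (shiftBy-+-shiftBy a b 1#)

  q^-*-cancelˡ : ∀ e {X Y} → q^ e * X ≈ q^ e * Y → X ≈ Y
  q^-*-cancelˡ e {X} {Y} eq n = begin
    X n                     ≡⟨ sym (shiftBy-at e X n) ⟩
    shiftBy e X (e +ℕ n)    ≡⟨ sym (q^-* e X (e +ℕ n)) ⟩
    (q^ e * X) (e +ℕ n)     ≡⟨ eq (e +ℕ n) ⟩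
    (q^ e * Y) (e +ℕ n)     ≡⟨ q^-* e Y (e +ℕ n) ⟩
    shiftBy e Y (e +ℕ n)    ≡⟨ shiftBy-at e Y n ⟩
    Y n                     ∎
    where open ≡-Reasoning

  q^-≈[]-0# : ∀ e K → K ≤ e → q^ e ≈[ K ] 0#
  q^-≈[]-0# e K K≤e n n<K = shiftBy-below e 1# n (ℕ.≤-trans n<K K≤e)

  infixr 8 _^_
  _^_ : Series → ℕ → Series
  X ^ zero  = 1#
  X ^ suc n = X * X ^ n

  ^-cong : ∀ {X Y} n → X ≈ Y → X ^ n ≈ Y ^ n
  ^-cong zero    p = ≈-refl
  ^-cong (suc n) p = *-cong p (^-cong n p)

  ^-≡ : ∀ X {a b} → a ≡ b → X ^ a ≈ X ^ b
  ^-≡ X refl = ≈-refl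

  ^-distribˡ-+-* : ∀ X a b → X ^ (a +ℕ b) ≈ X ^ a * X ^ b
  ^-distribˡ-+-* X zero    b = ≈-sym (*-identityˡ (X ^ b))
  ^-distribˡ-+-* X (suc a) b = ≈-trans (*-cong (≈-refl {X}) (^-distribˡ-+-* X a b)) (≈-sym (*-assoc X (X ^ a) (X ^ b)))

  ^-distribʳ-* : ∀ X Y n → (X * Y) ^ n ≈ X ^ n * Y ^ n
  ^-distribʳ-* X Y zero    = ≈-sym (*-identityˡ 1#)
  ^-distribʳ-* X Y (suc n) = ≈-trans (*-cong (≈-refl {X * Y}) (^-distribʳ-* X Y n))
    (solve 4 (λ x y a b → (x :* y) :* (a :* b) := (x :* a) :* (y :* b)) ≈-refl X Y (X ^ n) (Y ^ n))

  ^-*-assoc : ∀ X a b → (X ^ a) ^ b ≈ X ^ (a *ℕ b)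
  ^-*-assoc X a zero    = ^-≡ X (sym (ℕ.*-zeroʳ a))
  ^-*-assoc X a (suc b) = ≈-trans (*-cong (≈-refl {X ^ a}) (^-*-assoc X a b))
    (≈-trans (≈-sym (^-distribˡ-+-* X a (a *ℕ b))) (^-≡ X (sym (ℕ.*-suc a b))))

  ^-≈[]-1# : ∀ {X} K n → X ≈[ K ] 1# → X ^ n ≈[ K ] 1#
  ^-≈[]-1# K zero    p = ≈[]-refl K
  ^-≈[]-1# K (suc n) p = *-≈[]-1# K p (^-≈[]-1# K n p)

  1#-^ : ∀ n → 1# ^ n ≈ 1#
  1#-^ zero    = ≈-refl
  1#-^ (suc n) = ≈-trans (*-identityˡ (1# ^ n)) (1#-^ n)

  q^-^ : ∀ a n → q^ a ^ n ≈ q^ (a *ℕ n)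
  q^-^ a zero    = ≈-reflexive (cong q^_ (sym (ℕ.*-zeroʳ a)))
  q^-^ a (suc n) = ≈-trans (*-cong (≈-refl {q^ a}) (q^-^ a n))
    (≈-trans (q^-*-q^ a (a *ℕ n)) (≈-reflexive (cong q^_ (sym (ℕ.*-suc a n)))))

module Dilation where
  open Monomials public
  open import Data.Nat.Base using (ℕ; zero; suc; s≤s) renaming (_*_ to _*ℕ_)
  import Data.Nat.Properties as ℕ
  open import Relation.Binary.PropositionalEquality using (_≡_; refl; sym; trans; cong)
  open Solver using (solve; _:=_; _:*_; _:+_; _:^_)

  -- dilate X = X(q³)
  dilate : Series → Series
  dilate X zero                = X 0
  dilate X (suc zero)          = 0₃
  dilate X (suc (suc zero))    = 0₃
  dilate X (suc (suc (suc n))) = dilate (tail X) n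

  dilate-cong : ∀ {X Y} → X ≈ Y → dilate X ≈ dilate Y
  dilate-cong p zero                = p 0
  dilate-cong p (suc zero)          = refl
  dilate-cong p (suc (suc zero))    = refl
  dilate-cong p (suc (suc (suc n))) = dilate-cong (λ m → p (suc m)) n

  dilate-≈[] : ∀ {X Y} K → X ≈[ K ] Y → dilate X ≈[ K ] dilate Y
  dilate-≈[] K       p zero                0<K = p 0 0<K
  dilate-≈[] K       p (suc zero)          _   = refl
  dilate-≈[] K       p (suc (suc zero))    _   = refl
  dilate-≈[] (suc K) p (suc (suc (suc n))) (s≤s n+2<K) =
    dilate-≈[] K (λ m m<K → p (suc m) (s≤s m<K)) n (ℕ.≤-trans (ℕ.n≤1+n _) (ℕ.≤-trans (ℕ.n≤1+n _) n+2<K))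

  dilate-unfold : ∀ X → dilate X ≈ const (X 0) + shiftBy 3 (dilate (tail X))
  dilate-unfold X zero                = sym (+₃-identityʳ (X 0))
  dilate-unfold X (suc zero)          = refl
  dilate-unfold X (suc (suc zero))    = refl
  dilate-unfold X (suc (suc (suc n))) = refl

  dilate-+ : ∀ X Y → dilate (X + Y) ≈ dilate X + dilate Y
  dilate-+ X Y zero                = refl
  dilate-+ X Y (suc zero)          = refl
  dilate-+ X Y (suc (suc zero))    = refl
  dilate-+ X Y (suc (suc (suc n))) = dilate-+ (tail X) (tail Y) n

  dilate-- : ∀ X → dilate (- X) ≈ - dilate X
  dilate-- X zero                = refl
  dilate-- X (suc zero)          = refl
  dilate-- X (suc (suc zero))    = refl
  dilate-- X (suc (suc (suc n))) = dilate-- (tail X) n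

  dilate-· : ∀ c X → dilate (c · X) ≈ c · dilate X
  dilate-· c X zero                = refl
  dilate-· c X (suc zero)          = sym (*₃-zeroʳ c)
  dilate-· c X (suc (suc zero))    = sym (*₃-zeroʳ c)
  dilate-· c X (suc (suc (suc n))) = dilate-· c (tail X) n

  dilate-shift : ∀ X → dilate (shift X) ≈ shiftBy 3 (dilate X)
  dilate-shift X zero                = refl
  dilate-shift X (suc zero)          = refl
  dilate-shift X (suc (suc zero))    = refl
  dilate-shift X (suc (suc (suc n))) = refl

  dilate-0# : dilate 0# ≈ 0#
  dilate-0# zero                = refl
  dilate-0# (suc zero)          = refl
  dilate-0# (suc (suc zero))    = refl
  dilate-0# (suc (suc (suc n))) = dilate-0# n

  dilate-const : ∀ c → dilate (const c) ≈ const c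
  dilate-const c zero                = refl
  dilate-const c (suc zero)          = refl
  dilate-const c (suc (suc zero))    = refl
  dilate-const c (suc (suc (suc n))) = dilate-0# n

  dilate-1# : dilate 1# ≈ 1#
  dilate-1# = dilate-const 1₃

  const-* : ∀ c Y → const c * Y ≈ c · Y
  const-* c Y zero    = refl
  const-* c Y (suc n) = trans (cong (c *₃ Y (suc n) +₃_) (*-zeroˡ Y n)) (+₃-identityʳ _)

  private
    dilate-product-unfold : ∀ X Y → dilate (X * Y) ≈ X 0 · dilate Y + shiftBy 3 (dilate (tail X * Y))
    dilate-product-unfold X Y = begin
      dilate (X * Y)                                    ≈⟨ dilate-cong (*-unfold X Y) ⟩
      dilate (X 0 · Y + shift (tail X * Y))             ≈⟨ dilate-+ (X 0 · Y) (shift (tail X * Y)) ⟩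
      dilate (X 0 · Y) + dilate (shift (tail X * Y))    ≈⟨ +-cong (dilate-· (X 0) Y) (dilate-shift (tail X * Y)) ⟩
      X 0 · dilate Y + shiftBy 3 (dilate (tail X * Y))  ∎
      where open ≈-Reasoning

  dilated-*-unfold : ∀ X Y → dilate X * Y ≈ X 0 · Y + shiftBy 3 (dilate (tail X) * Y)
  dilated-*-unfold X Y = begin
    dilate X * Y                                         ≈⟨ *-cong (dilate-unfold X) (≈-refl {Y}) ⟩
    (const (X 0) + shiftBy 3 (dilate (tail X))) * Y      ≈⟨ *-distribʳ-+ Y (const (X 0)) _ ⟩
    const (X 0) * Y + shiftBy 3 (dilate (tail X)) * Y    ≈⟨ +-cong (const-* (X 0) Y) (shiftBy-*-assoc 3 _ Y) ⟩
    X 0 · Y + shiftBy 3 (dilate (tail X) * Y)            ∎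
    where open ≈-Reasoning

  dilate-* : ∀ X Y → dilate (X * Y) ≈ dilate X * dilate Y
  dilate-* X Y n@zero                = trans (dilate-product-unfold X Y n) (sym (dilated-*-unfold X (dilate Y) n))
  dilate-* X Y n@(suc zero)          = trans (dilate-product-unfold X Y n) (sym (dilated-*-unfold X (dilate Y) n))
  dilate-* X Y n@(suc (suc zero))    = trans (dilate-product-unfold X Y n) (sym (dilated-*-unfold X (dilate Y) n))
  dilate-* X Y n@(suc (suc (suc m))) =
    trans (dilate-product-unfold X Y n)
      (trans (cong (X 0 *₃ dilate Y n +₃_) (dilate-* (tail X) Y m)) (sym (dilated-*-unfold X (dilate Y) n)))

  dilate-^ : ∀ X n → dilate (X ^ n) ≈ dilate X ^ n
  dilate-^ X zero    = dilate-1#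
  dilate-^ X (suc n) = ≈-trans (dilate-* X (X ^ n)) (*-cong (≈-refl {dilate X}) (dilate-^ X n))

  dilate-q^ : ∀ e → dilate (q^ e) ≈ q^ (3 *ℕ e)
  dilate-q^ zero    = dilate-1#
  dilate-q^ (suc e) = ≈-trans (dilate-shift (q^ e))
    (≈-trans (shiftBy-cong 3 (dilate-q^ e)) (≈-reflexive (cong q^_ (sym (ℕ.*-suc 3 e)))))

  -- (c + q Y)³ = c³ + q³ Y³ in characteristic 3, and c³ = c on 𝔽₃.
  private
    cube-unfold : ∀ X → X ^ 3 ≈ const (X 0) + shiftBy 3 (tail X ^ 3)
    cube-unfold X = begin
      X ^ 3                               ≈⟨ ^-cong 3 X≈c+qY ⟩
      (c + q^ 1 * Y) ^ 3                  ≈⟨ solve 3 (λ c q y → (c :+ q :* y) :^ 3 := c :* c :* c :+ (q :* q :* q) :* y :^ 3)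
                                                     ≈-refl c (q^ 1) Y ⟩
      c * c * c + (q^ 1 * q^ 1 * q^ 1) * Y ^ 3
        ≈⟨ +-cong c³≈c (≈-trans (*-cong (≈-trans (*-cong (q^-*-q^ 1 1) (≈-refl {q^ 1})) (q^-*-q^ 2 1)) (≈-refl {Y ^ 3})) (q^-* 3 (Y ^ 3))) ⟩
      const (X 0) + shiftBy 3 (Y ^ 3)     ∎
      where
      open ≈-Reasoning
      c Y : Series
      c = const (X 0)
      Y = tail X
      X≈c+qY : X ≈ c + q^ 1 * Y
      X≈c+qY zero    = sym (+₃-identityʳ (X 0))
      X≈c+qY (suc n) = sym (q^-* 1 Y (suc n))
      c³≈c : c * c * c ≈ c
      c³≈c = ≈-trans (*-cong (≈-sym (const-*-homo (X 0) (X 0))) (≈-refl {c}))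
        (≈-trans (≈-sym (const-*-homo (X 0 *₃ X 0) (X 0))) (≈-reflexive (cong const (x*x*x≡x (X 0)))))

  frobenius : ∀ X → X ^ 3 ≈ dilate X
  frobenius X n@zero                = trans (cube-unfold X n) (sym (dilate-unfold X n))
  frobenius X n@(suc zero)          = trans (cube-unfold X n) (sym (dilate-unfold X n))
  frobenius X n@(suc (suc zero))    = trans (cube-unfold X n) (sym (dilate-unfold X n))
  frobenius X n@(suc (suc (suc m))) =
    trans (cube-unfold X n) (trans (cong (const (X 0) n +₃_) (frobenius (tail X) m)) (sym (dilate-unfold X n)))

  U₃ : Series → Series
  U₃ X n = X (3 *ℕ n)

  U₃-cong : ∀ {X Y} → X ≈ Y → U₃ X ≈ U₃ Y
  U₃-cong p n = p (3 *ℕ n)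

  U₃-shiftBy-3 : ∀ X → U₃ (shiftBy 3 X) ≈ shift (U₃ X)
  U₃-shiftBy-3 X zero    = refl
  U₃-shiftBy-3 X (suc n) = cong (shiftBy 3 X) (ℕ.*-suc 3 n)

  U₃-dilate : ∀ X → U₃ (dilate X) ≈ X
  U₃-dilate X zero    = refl
  U₃-dilate X (suc n) = trans (cong (dilate X) (ℕ.*-suc 3 n)) (U₃-dilate (tail X) n)

  U₃-shift-dilate : ∀ X → U₃ (shift (dilate X)) ≈ 0#
  U₃-shift-dilate X zero    = refl
  U₃-shift-dilate X (suc n) = trans (cong (shift (dilate X)) (ℕ.*-suc 3 n)) (at-3*+2 X n)
    where
    at-3*+2 : ∀ X n → dilate X (suc (suc (3 *ℕ n))) ≡ 0₃
    at-3*+2 X zero    = refl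
    at-3*+2 X (suc n) = trans (cong (λ k → dilate X (suc (suc k))) (ℕ.*-suc 3 n)) (at-3*+2 (tail X) n)

  U₃-shift²-dilate : ∀ X → U₃ (shift (shift (dilate X))) ≈ 0#
  U₃-shift²-dilate X zero    = refl
  U₃-shift²-dilate X (suc n) = trans (cong (shift (shift (dilate X))) (ℕ.*-suc 3 n)) (at-3*+1 X n)
    where
    at-3*+1 : ∀ X n → dilate X (suc (3 *ℕ n)) ≡ 0₃
    at-3*+1 X zero    = refl
    at-3*+1 X (suc n) = trans (cong (λ k → dilate X (suc k)) (ℕ.*-suc 3 n)) (at-3*+1 (tail X) n)

  U₃-dilate-* : ∀ X Y → U₃ (dilate X * Y) ≈ X * U₃ Y
  U₃-dilate-* X Y zero    = trans (U₃-cong (dilated-*-unfold X Y) 0) (+₃-identityʳ _)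
  U₃-dilate-* X Y (suc n) = trans (U₃-cong (dilated-*-unfold X Y) (suc n))
    (cong (X 0 *₃ U₃ Y (suc n) +₃_) (trans (U₃-shiftBy-3 (dilate (tail X) * Y) (suc n)) (U₃-dilate-* (tail X) Y n)))

module InfiniteProducts where
  open Dilation public
  open import Data.Nat.Base using (ℕ; zero; suc; _<_; _≤_; _∸_; z≤n; s≤s) renaming (_+_ to _+ℕ_; _*_ to _*ℕ_)
  import Data.Nat.Properties as ℕ
  open import Relation.Binary.PropositionalEquality as ≡ using (_≡_; module ≡-Reasoning)

  -- The infinite ⨀ h is defined coefficientwise: if the k-th term is ≡ ε
  -- modulo q^k, the coefficient of q^N is already that of the first N + 1 terms.
  module BigOperator (_∙_ : Series → Series → Series) (ε : Series)
    (∙-cong : ∀ {X X′ Y Y′} → X ≈ X′ → Y ≈ Y′ → X ∙ Y ≈ X′ ∙ Y′)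
    (∙-cong-≈[] : ∀ {X X′ Y Y′} K → X ≈[ K ] X′ → Y ≈[ K ] Y′ → X ∙ Y ≈[ K ] X′ ∙ Y′)
    (∙-assoc : ∀ X Y Z → (X ∙ Y) ∙ Z ≈ X ∙ (Y ∙ Z))
    (∙-comm : ∀ X Y → X ∙ Y ≈ Y ∙ X)
    (∙-identityˡ : ∀ X → ε ∙ X ≈ X)
    where

    infix 25 [<_]_

    [<_]_ : ℕ → (ℕ → Series) → Series
    [< zero  ] h = ε
    [< suc n ] h = h 0 ∙ [< n ] (λ k → h (suc k))

    Convergent : (ℕ → Series) → Set
    Convergent h = ∀ k → h k ≈[ k ] ε

    ⨀ : (ℕ → Series) → Series
    ⨀ h N = ([< suc N ] h) N

    ∙-identityʳ : ∀ X → X ∙ ε ≈ X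
    ∙-identityʳ X = ≈-trans (∙-comm X ε) (∙-identityˡ X)

    <-cong : ∀ {h h′} n → (∀ k → k < n → h k ≈ h′ k) → [< n ] h ≈ [< n ] h′
    <-cong zero    p = ≈-refl
    <-cong (suc n) p = ∙-cong (p 0 (s≤s z≤n)) (<-cong n (λ k k<n → p (suc k) (s≤s k<n)))

    <-cong-≈[] : ∀ {h h′} K n → (∀ k → k < n → h k ≈[ K ] h′ k) → [< n ] h ≈[ K ] [< n ] h′
    <-cong-≈[] K zero    p = ≈[]-refl K
    <-cong-≈[] K (suc n) p = ∙-cong-≈[] K (p 0 (s≤s z≤n)) (<-cong-≈[] K n (λ k k<n → p (suc k) (s≤s k<n)))

    <-split : ∀ h a b → [< a +ℕ b ] h ≈ [< a ] h ∙ [< b ] (λ k → h (a +ℕ k))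
    <-split h zero    b = ≈-sym (∙-identityˡ ([< b ] h))
    <-split h (suc a) b = ≈-trans (∙-cong (≈-refl {h 0}) (<-split (λ k → h (suc k)) a b))
      (≈-sym (∙-assoc (h 0) ([< a ] (λ k → h (suc k))) ([< b ] (λ k → h (suc (a +ℕ k))))))

    <-snoc : ∀ h n → [< suc n ] h ≈ [< n ] h ∙ h n
    <-snoc h zero    = ∙-comm (h 0) ε
    <-snoc h (suc n) = ≈-trans (∙-cong (≈-refl {h 0}) (<-snoc (λ k → h (suc k)) n))
      (≈-sym (∙-assoc (h 0) ([< n ] (λ k → h (suc k))) (h (suc n))))

    <-reverse : ∀ h n → [< n ] h ≈ [< n ] (λ t → h (n ∸ suc t))
    <-reverse h zero    = ≈-refl
    <-reverse h (suc n) = ≈-trans (∙-cong (≈-refl {h 0}) (<-reverse (λ k → h (suc k)) n))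
      (≈-trans (∙-comm (h 0) ([< n ] (λ t → h (suc (n ∸ suc t)))))
        (≈-sym (≈-trans (<-snoc (λ t → h (suc n ∸ suc t)) n)
          (∙-cong (<-cong n (λ t t<n → ≈-reflexive (≡.cong h (ℕ.+-∸-assoc 1 t<n))))
                  (≈-reflexive (≡.cong h (ℕ.n∸n≡0 n)))))))

    <-chunks : ∀ p h n → [< p *ℕ n ] h ≈ [< n ] (λ t → [< p ] (λ r → h (r +ℕ p *ℕ t)))
    <-chunks p h zero    = ≈-reflexive (≡.cong (λ m → [< m ] h) (ℕ.*-zeroʳ p))
    <-chunks p h (suc n) = begin
      [< p *ℕ suc n ] h
        ≈⟨ ≈-reflexive (≡.cong (λ m → [< m ] h) (ℕ.*-suc p n)) ⟩
      [< p +ℕ p *ℕ n ] h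
        ≈⟨ <-split h p (p *ℕ n) ⟩
      [< p ] h ∙ [< p *ℕ n ] (λ i → h (p +ℕ i))
        ≈⟨ ∙-cong (<-cong p (λ r _ → ≈-reflexive (≡.cong h (≡.sym (≡.trans (≡.cong (r +ℕ_) (ℕ.*-zeroʳ p)) (ℕ.+-identityʳ r))))))
                  (≈-trans (<-chunks p (λ i → h (p +ℕ i)) n)
                           (<-cong n (λ t _ → <-cong p (λ r _ → ≈-reflexive (≡.cong h (index t r)))))) ⟩
      [< p ] (λ r → h (r +ℕ p *ℕ 0)) ∙ [< n ] (λ t → [< p ] (λ r → h (r +ℕ p *ℕ suc t)))
        ∎
      where
      open ≈-Reasoning
      index : ∀ t r → p +ℕ (r +ℕ p *ℕ t) ≡ r +ℕ p *ℕ suc t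
      index t r = ≡.trans (ℕ.+-comm p (r +ℕ p *ℕ t)) (≡.trans (ℕ.+-assoc r (p *ℕ t) p)
        (≡.cong (r +ℕ_) (≡.trans (ℕ.+-comm (p *ℕ t) p) (≡.sym (ℕ.*-suc p t)))))

    <-merge : ∀ h h′ n → [< n ] h ∙ [< n ] h′ ≈ [< n ] (λ k → h k ∙ h′ k)
    <-merge h h′ zero    = ∙-identityˡ ε
    <-merge h h′ (suc n) = begin
      (h 0 ∙ H) ∙ (h′ 0 ∙ H′)   ≈⟨ ∙-assoc (h 0) H (h′ 0 ∙ H′) ⟩
      h 0 ∙ (H ∙ (h′ 0 ∙ H′))   ≈⟨ ∙-cong (≈-refl {h 0}) (≈-sym (∙-assoc H (h′ 0) H′)) ⟩
      h 0 ∙ ((H ∙ h′ 0) ∙ H′)   ≈⟨ ∙-cong (≈-refl {h 0}) (∙-cong (∙-comm H (h′ 0)) (≈-refl {H′})) ⟩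
      h 0 ∙ ((h′ 0 ∙ H) ∙ H′)   ≈⟨ ∙-cong (≈-refl {h 0}) (∙-assoc (h′ 0) H H′) ⟩
      h 0 ∙ (h′ 0 ∙ (H ∙ H′))   ≈⟨ ≈-sym (∙-assoc (h 0) (h′ 0) (H ∙ H′)) ⟩
      (h 0 ∙ h′ 0) ∙ (H ∙ H′)   ≈⟨ ∙-cong (≈-refl {h 0 ∙ h′ 0}) (<-merge (λ k → h (suc k)) (λ k → h′ (suc k)) n) ⟩
      (h 0 ∙ h′ 0) ∙ [< n ] (λ k → h (suc k) ∙ h′ (suc k)) ∎
      where
      open ≈-Reasoning
      H H′ : Series
      H  = [< n ] (λ k → h (suc k))
      H′ = [< n ] (λ k → h′ (suc k))

    <-≈[]-ε : ∀ {h} K n → (∀ k → h k ≈[ K ] ε) → [< n ] h ≈[ K ] ε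
    <-≈[]-ε K zero    p = ≈[]-refl K
    <-≈[]-ε K (suc n) p = ≈[]-trans K (∙-cong-≈[] K (p 0) (<-≈[]-ε K n (λ k → p (suc k)))) (≈⇒≈[] K (∙-identityˡ ε))

    <-split-≈[] : ∀ h j d K → (∀ k → j ≤ k → h k ≈[ K ] ε) → [< j +ℕ d ] h ≈[ K ] [< j ] h
    <-split-≈[] h j d K p = ≈[]-trans K (≈⇒≈[] K (<-split h j d))
      (≈[]-trans K (∙-cong-≈[] K (≈[]-refl K) (<-≈[]-ε K d (λ k → p (j +ℕ k) (ℕ.m≤m+n j k))))
        (≈⇒≈[] K (∙-identityʳ ([< j ] h))))

    convergent-≤ : ∀ {h} → Convergent h → ∀ j k → j ≤ k → h k ≈[ j ] ε
    convergent-≤ conv j k j≤k = ≈[]-weaken j≤k (conv k)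

    ≈[]-< : ∀ {h} j K → Convergent h → (∀ k → j ≤ k → h k ≈[ K ] ε) → ⨀ h ≈[ K ] [< j ] h
    ≈[]-< {h} j K conv p n n<K = begin
      ([< suc n ] h) n           ≡⟨ ≡.sym (<-split-≈[] h (suc n) j (suc n) (convergent-≤ conv (suc n)) n ℕ.≤-refl) ⟩
      ([< suc n +ℕ j ] h) n      ≡⟨ ≡.cong (λ m → ([< m ] h) n) (ℕ.+-comm (suc n) j) ⟩
      ([< j +ℕ suc n ] h) n      ≡⟨ <-split-≈[] h j (suc n) K p n n<K ⟩
      ([< j ] h) n               ∎
      where open ≡-Reasoning

    ≈[]-<-self : ∀ {h} N → Convergent h → ⨀ h ≈[ N ] [< N ] h
    ≈[]-<-self N conv = ≈[]-< N N conv (convergent-≤ conv N)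

    cong : ∀ {h h′} → (∀ k → h k ≈ h′ k) → ⨀ h ≈ ⨀ h′
    cong p N = <-cong (suc N) (λ k _ → p k) N

    merge : ∀ {h h′} → Convergent h → Convergent h′ → ⨀ h ∙ ⨀ h′ ≈ ⨀ (λ k → h k ∙ h′ k)
    merge {h} {h′} conv conv′ N =
      ≡.trans (∙-cong-≈[] (suc N) (≈[]-<-self (suc N) conv) (≈[]-<-self (suc N) conv′) N ℕ.≤-refl) (<-merge h h′ (suc N) N)

    unfold : ∀ {h} → Convergent h → ⨀ h ≈ h 0 ∙ ⨀ (λ k → h (suc k))
    unfold {h} conv N = ∙-cong-≈[] (suc N) (≈[]-refl (suc N)) (≈[]-sym (suc N) tail≈) N ℕ.≤-refl
      where
      conv′ : Convergent (λ k → h (suc k))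
      conv′ k = ≈[]-weaken (ℕ.n≤1+n k) (conv (suc k))
      tail≈ : ⨀ (λ k → h (suc k)) ≈[ suc N ] [< N ] (λ k → h (suc k))
      tail≈ = ≈[]-< N (suc N) conv′ (λ k N≤k → ≈[]-weaken (s≤s N≤k) (conv (suc k)))

    blocks : ∀ {h} h′ s → Convergent h → (∀ n → [< suc s *ℕ n ] h ≈ [< n ] h′) → ⨀ h ≈ ⨀ h′
    blocks {h} h′ s conv p N =
      ≡.trans (≡.sym (<-split-≈[] h (suc N) (s *ℕ suc N) (suc N) (convergent-≤ conv (suc N)) N ℕ.≤-refl)) (p (suc N) N)

    chunks : ∀ p {h} → Convergent h → ⨀ h ≈ ⨀ (λ t → [< suc p ] (λ r → h (r +ℕ suc p *ℕ t)))
    chunks p {h} conv = blocks _ p conv (<-chunks (suc p) h)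

    <-hom : ∀ (F : Series → Series) → (∀ X Y → F (X ∙ Y) ≈ F X ∙ F Y) → F ε ≈ ε →
      ∀ h n → [< n ] (λ k → F (h k)) ≈ F ([< n ] h)
    <-hom F F-∙ F-ε h zero    = ≈-sym F-ε
    <-hom F F-∙ F-ε h (suc n) = ≈-trans (∙-cong (≈-refl {F (h 0)}) (<-hom F F-∙ F-ε (λ k → h (suc k)) n))
      (≈-sym (F-∙ (h 0) ([< n ] (λ k → h (suc k)))))

    hom : ∀ (F : Series → Series) → (∀ X Y → F (X ∙ Y) ≈ F X ∙ F Y) → F ε ≈ ε →
      (∀ {X Y} K → X ≈[ K ] Y → F X ≈[ K ] F Y) → ∀ {h} → Convergent h → ⨀ (λ k → F (h k)) ≈ F (⨀ h)
    hom F F-∙ F-ε F-≈[] {h} conv N =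
      ≡.trans (<-hom F F-∙ F-ε h (suc N) N) (≡.sym (F-≈[] (suc N) (≈[]-<-self (suc N) conv) N ℕ.≤-refl))

  module ∏ = BigOperator _*_ 1# *-cong *-cong-≈[] *-assoc *-comm *-identityˡ
  module ∑ = BigOperator _+_ 0# +-cong +-cong-≈[] +-assoc +-comm +-identityˡ
  open ∏ public using () renaming ([<_]_ to ∏[<_]_; ⨀ to ∏; Convergent to Multipliable)
  open ∑ public using () renaming ([<_]_ to ∑[<_]_; ⨀ to ∑; Convergent to Summable)

  ∏<-const : ∀ X n → ∏[< n ] (λ _ → X) ≈ X ^ n
  ∏<-const X zero    = ≈-refl
  ∏<-const X (suc n) = *-cong (≈-refl {X}) (∏<-const X n)

  ∑<-*ʳ : ∀ h n Y → ∑[< n ] h * Y ≈ ∑[< n ] (λ k → h k * Y)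
  ∑<-*ʳ h zero    Y = *-zeroˡ Y
  ∑<-*ʳ h (suc n) Y = ≈-trans (*-distribʳ-+ Y (h 0) (∑[< n ] (λ k → h (suc k))))
    (+-cong (≈-refl {h 0 * Y}) (∑<-*ʳ (λ k → h (suc k)) n Y))

  ∑<-*ˡ : ∀ Y h n → Y * ∑[< n ] h ≈ ∑[< n ] (λ k → Y * h k)
  ∑<-*ˡ Y h n = ≈-trans (*-comm Y (∑[< n ] h)) (≈-trans (∑<-*ʳ h n Y) (∑.<-cong n (λ k _ → *-comm (h k) Y)))

  ∏-dilate : ∀ {h} → Multipliable h → ∏ (λ k → dilate (h k)) ≈ dilate (∏ h)
  ∏-dilate = ∏.hom dilate dilate-* dilate-1# dilate-≈[]

  ∑-dilate : ∀ {h} → Summable h → ∑ (λ k → dilate (h k)) ≈ dilate (∑ h)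
  ∑-dilate = ∑.hom dilate dilate-+ dilate-0# dilate-≈[]

  ∑-shiftBy : ∀ {h} e → Summable h → ∑ (λ k → shiftBy e (h k)) ≈ shiftBy e (∑ h)
  ∑-shiftBy e = ∑.hom (shiftBy e) (shiftBy-+ e) (shiftBy-0# e)
    (λ K X≈[K]Y → ≈[]-weaken (ℕ.m≤n+m K e) (shiftBy-≈[] e K X≈[K]Y))

module TriangularNumbers where
  open import Data.Nat.Base using (ℕ; zero; suc; _+_; _*_)
  open import Data.Nat.Properties using (+-identityʳ)
  open import Data.Nat.Tactic.RingSolver using (solve-∀)
  open import Relation.Binary.PropositionalEquality using (_≡_; refl; sym; cong; module ≡-Reasoning)

  -- triangle k = k (k - 1) / 2
  triangle : ℕ → ℕ
  triangle zero    = 0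
  triangle (suc k) = k + triangle k

  triangle-+ : ∀ a b → triangle (a + b) ≡ triangle a + triangle b + a * b
  triangle-+ zero    b = sym (+-identityʳ (triangle b))
  triangle-+ (suc a) b = begin
    a + b + triangle (a + b)                      ≡⟨ cong (a + b +_) (triangle-+ a b) ⟩
    a + b + (triangle a + triangle b + a * b)     ≡⟨ rearrange a b (triangle a) (triangle b) ⟩
    a + triangle a + triangle b + suc a * b       ∎
    where
    open ≡-Reasoning
    rearrange : ∀ a b s t → a + b + (s + t + a * b) ≡ a + s + t + suc a * b
    rearrange = solve-∀

  2*triangle+id : ∀ j → 2 * triangle j + j ≡ j * j
  2*triangle+id zero    = refl
  2*triangle+id (suc j) = begin
    2 * (j + triangle j) + suc j     ≡⟨ rearrange j (triangle j) ⟩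
    (2 * triangle j + j) + (1 + j + j) ≡⟨ cong (_+ (1 + j + j)) (2*triangle+id j) ⟩
    j * j + (1 + j + j)              ≡⟨ square-suc j ⟩
    suc j * suc j                    ∎
    where
    open ≡-Reasoning
    rearrange : ∀ j t → 2 * (j + t) + suc j ≡ (2 * t + j) + (1 + j + j)
    rearrange = solve-∀
    square-suc : ∀ j → j * j + (1 + j + j) ≡ suc j * suc j
    square-suc = solve-∀

module QBinomial where
  open InfiniteProducts public
  open TriangularNumbers public
  open import Data.Nat.Base using (ℕ; zero; suc; _<_; _≤_; _∸_; s≤s) renaming (_+_ to _+ℕ_)
  import Data.Nat.Properties as ℕ
  open import Relation.Binary.PropositionalEquality using (_≡_; refl; sym; trans; cong)
  open import Data.Sum.Base using (inj₁; inj₂)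
  open Solver using (solve; _:=_; _:*_; _:+_; _:-_; con)

  gaussian : Series → ℕ → ℕ → Series
  gaussian Q zero    zero    = 1#
  gaussian Q zero    (suc k) = 0#
  gaussian Q (suc m) zero    = 1#
  gaussian Q (suc m) (suc k) = gaussian Q m (suc k) + Q ^ (m ∸ k) * gaussian Q m k

  gaussian-0 : ∀ Q m → gaussian Q m 0 ≈ 1#
  gaussian-0 Q zero    = ≈-refl
  gaussian-0 Q (suc m) = ≈-refl

  gaussian-> : ∀ Q m k → m < k → gaussian Q m k ≈ 0#
  gaussian-> Q zero    (suc k) _         = ≈-refl
  gaussian-> Q (suc m) (suc k) (s≤s m<k) =
    ≈-trans (+-cong (gaussian-> Q m (suc k) (ℕ.m<n⇒m<1+n m<k)) (*-cong (≈-refl {Q ^ (m ∸ k)}) (gaussian-> Q m k m<k)))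
      (*-zeroʳ (Q ^ (m ∸ k)))

  private
    term : Series → Series → ℕ → ℕ → Series
    term Q X m k = gaussian Q m k * Q ^ triangle k * X ^ (m ∸ k)

    expansion-*X : ∀ Q X m → ∑[< suc m ] (term Q X m) * X
      ≈ X ^ suc m + ∑[< suc m ] (λ k → gaussian Q m (suc k) * Q ^ triangle (suc k) * X ^ (m ∸ k))
    expansion-*X Q X m = begin
      ∑[< suc m ] (term Q X m) * X                              ≈⟨ ∑<-*ʳ (term Q X m) (suc m) X ⟩
      term Q X m 0 * X + ∑[< m ] (λ k → term Q X m (suc k) * X)  ≈⟨ +-cong lowest (∑.<-cong m shifted) ⟩
      X ^ suc m + ∑[< m ] A                                     ≈⟨ +-cong (≈-refl {X ^ suc m}) (≈-sym extend) ⟩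
      X ^ suc m + ∑[< suc m ] A                                 ∎
      where
      open ≈-Reasoning
      A : ℕ → Series
      A k = gaussian Q m (suc k) * Q ^ triangle (suc k) * X ^ (m ∸ k)
      lowest : term Q X m 0 * X ≈ X ^ suc m
      lowest = ≈-trans (*-cong (*-cong (*-cong (gaussian-0 Q m) (≈-refl {1#})) (≈-refl {X ^ m})) (≈-refl {X}))
        (solve 2 (λ x xᵐ → con 1₃ :* con 1₃ :* xᵐ :* x := x :* xᵐ) ≈-refl X (X ^ m))
      shifted : ∀ k → k < m → term Q X m (suc k) * X ≈ A k
      shifted k k<m = ≈-trans (*-assoc (gaussian Q m (suc k) * Q ^ triangle (suc k)) (X ^ (m ∸ suc k)) X)
        (*-cong (≈-refl {gaussian Q m (suc k) * Q ^ triangle (suc k)})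
          (≈-trans (*-comm (X ^ (m ∸ suc k)) X) (^-≡ X (sym (ℕ.+-∸-assoc 1 k<m)))))
      A[m]≈0 : A m ≈ 0#
      A[m]≈0 = ≈-trans (*-cong (*-cong (gaussian-> Q m (suc m) ℕ.≤-refl) (≈-refl {Q ^ triangle (suc m)})) (≈-refl {X ^ (m ∸ m)}))
        (≈-trans (*-cong (*-zeroˡ (Q ^ triangle (suc m))) (≈-refl {X ^ (m ∸ m)})) (*-zeroˡ (X ^ (m ∸ m))))
      extend : ∑[< suc m ] A ≈ ∑[< m ] A
      extend = ≈-trans (∑.<-snoc A m) (≈-trans (+-cong (≈-refl {∑[< m ] A}) A[m]≈0) (+-identityʳ (∑[< m ] A)))

    expansion-*Qᵐ : ∀ Q X m → ∑[< suc m ] (term Q X m) * Q ^ m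
      ≈ ∑[< suc m ] (λ k → gaussian Q m k * Q ^ triangle (suc k) * X ^ (m ∸ k) * Q ^ (m ∸ k))
    expansion-*Qᵐ Q X m = ≈-trans (∑<-*ʳ (term Q X m) (suc m) (Q ^ m)) (∑.<-cong (suc m) (λ k k≤m → moved k (ℕ.≤-pred k≤m)))
      where
      Qᵗ-moved : ∀ k → k ≤ m → Q ^ triangle k * Q ^ m ≈ Q ^ triangle (suc k) * Q ^ (m ∸ k)
      Qᵗ-moved k k≤m = ≈-trans (≈-sym (^-distribˡ-+-* Q (triangle k) m)) (≈-trans (^-≡ Q exponents) (^-distribˡ-+-* Q (k +ℕ triangle k) (m ∸ k)))
        where
        exponents : triangle k +ℕ m ≡ (k +ℕ triangle k) +ℕ (m ∸ k)
        exponents = trans (cong (triangle k +ℕ_) (sym (ℕ.m+[n∸m]≡n k≤m)))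
          (trans (sym (ℕ.+-assoc (triangle k) k (m ∸ k))) (cong (_+ℕ (m ∸ k)) (ℕ.+-comm (triangle k) k)))
      moved : ∀ k → k ≤ m → term Q X m k * Q ^ m ≈ gaussian Q m k * Q ^ triangle (suc k) * X ^ (m ∸ k) * Q ^ (m ∸ k)
      moved k k≤m = ≈-trans
        (solve 4 (λ g a x b → g :* a :* x :* b := g :* (a :* b) :* x) ≈-refl (gaussian Q m k) (Q ^ triangle k) (X ^ (m ∸ k)) (Q ^ m))
        (≈-trans (*-cong (*-cong (≈-refl {gaussian Q m k}) (Qᵗ-moved k k≤m)) (≈-refl {X ^ (m ∸ k)}))
          (solve 4 (λ g a b x → g :* (a :* b) :* x := g :* a :* x :* b) ≈-refl
            (gaussian Q m k) (Q ^ triangle (suc k)) (Q ^ (m ∸ k)) (X ^ (m ∸ k))))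

  q-binomial : ∀ Q X m →
    ∏[< m ] (λ t → X + Q ^ t) ≈ ∑[< suc m ] (λ k → gaussian Q m k * Q ^ triangle k * X ^ (m ∸ k))
  q-binomial Q X zero    = ≈-sym (≈-trans (+-identityʳ _) (≈-trans (*-identityʳ (1# * 1#)) (*-identityʳ 1#)))
  q-binomial Q X (suc m) = begin
    ∏[< suc m ] (λ t → X + Q ^ t)                 ≈⟨ ∏.<-snoc (λ t → X + Q ^ t) m ⟩
    ∏[< m ] (λ t → X + Q ^ t) * (X + Q ^ m)       ≈⟨ *-cong (q-binomial Q X m) (≈-refl {X + Q ^ m}) ⟩
    S * (X + Q ^ m)                               ≈⟨ *-distribˡ-+ S X (Q ^ m) ⟩
    S * X + S * Q ^ m                             ≈⟨ +-cong (expansion-*X Q X m) (expansion-*Qᵐ Q X m) ⟩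
    (X ^ suc m + ∑[< suc m ] A) + ∑[< suc m ] B   ≈⟨ +-assoc (X ^ suc m) (∑[< suc m ] A) (∑[< suc m ] B) ⟩
    X ^ suc m + (∑[< suc m ] A + ∑[< suc m ] B)   ≈⟨ +-cong first-term (≈-trans (∑.<-merge A B (suc m)) (∑.<-cong (suc m) (λ k _ → ≈-sym (pascal k)))) ⟩
    term Q X (suc m) 0 + ∑[< suc m ] (λ k → term Q X (suc m) (suc k))  ∎
    where
    open ≈-Reasoning
    S : Series
    S = ∑[< suc m ] (term Q X m)
    A B : ℕ → Series
    A k = gaussian Q m (suc k) * Q ^ triangle (suc k) * X ^ (m ∸ k)
    B k = gaussian Q m k * Q ^ triangle (suc k) * X ^ (m ∸ k) * Q ^ (m ∸ k)
    first-term : X ^ suc m ≈ term Q X (suc m) 0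
    first-term = ≈-sym (≈-trans (*-cong (*-identityˡ 1#) (≈-refl {X ^ suc m})) (*-identityˡ (X ^ suc m)))
    pascal : ∀ k → term Q X (suc m) (suc k) ≈ A k + B k
    pascal k = solve 5 (λ a b d e c → (a :+ d :* b) :* e :* c := a :* e :* c :+ b :* e :* c :* d) ≈-refl
      (gaussian Q m (suc k)) (gaussian Q m k) (Q ^ (m ∸ k)) (Q ^ triangle (suc k)) (X ^ (m ∸ k))

  pochhammer : Series → ℕ → Series
  pochhammer Q n = ∏[< n ] (λ t → 1# - Q ^ suc t)

  pochhammer-suc : ∀ Q n → pochhammer Q (suc n) ≈ pochhammer Q n * (1# - Q ^ suc n)
  pochhammer-suc Q n = ∏.<-snoc (λ t → 1# - Q ^ suc t) n

  gaussian-diagonal : ∀ Q m → gaussian Q m m ≈ 1#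
  gaussian-diagonal Q zero    = ≈-refl
  gaussian-diagonal Q (suc m) = begin
    gaussian Q m (suc m) + Q ^ (m ∸ m) * gaussian Q m m  ≈⟨ +-cong (gaussian-> Q m (suc m) ℕ.≤-refl)
                                                                   (*-cong (^-≡ Q (ℕ.n∸n≡0 m)) (gaussian-diagonal Q m)) ⟩
    0# + 1# * 1#                                         ≈⟨ *-identityˡ 1# ⟩
    1#                                                   ∎
    where open ≈-Reasoning

  private
    pochhammer-pascal : ∀ Q m k → k < m →
      gaussian Q m (suc k) * pochhammer Q (suc k) * pochhammer Q (m ∸ suc k) ≈ pochhammer Q m →
      gaussian Q m k * pochhammer Q k * pochhammer Q (m ∸ k) ≈ pochhammer Q m →
      gaussian Q (suc m) (suc k) * pochhammer Q (suc k) * pochhammer Q (m ∸ k) ≈ pochhammer Q (suc m)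
    pochhammer-pascal Q m k k<m IH₁ IH₀ = begin
      (a₁ + Q ^ (m ∸ k) * a₀) * P (suc k) * P (m ∸ k)
        ≈⟨ *-cong (*-cong (+-cong (≈-refl {a₁}) (*-cong (^-≡ Q m∸k≡1+d) (≈-refl {a₀}))) (pochhammer-suc Q k))
                  (≈-trans (≈-reflexive (cong P m∸k≡1+d)) (pochhammer-suc Q d)) ⟩
      (a₁ + W * a₀) * (P k * (1# - Z)) * (P d * (1# - W))
        ≈⟨ solve 6 (λ a₁ a₀ w z p r → (a₁ :+ w :* a₀) :* (p :* (con 1₃ :- z)) :* (r :* (con 1₃ :- w))
                     := (a₁ :* (p :* (con 1₃ :- z)) :* r) :* (con 1₃ :- w) :+ w :* (con 1₃ :- z) :* (a₀ :* p :* (r :* (con 1₃ :- w))))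
                   ≈-refl a₁ a₀ W Z (P k) (P d) ⟩
      (a₁ * (P k * (1# - Z)) * P d) * (1# - W) + W * (1# - Z) * (a₀ * P k * (P d * (1# - W)))
        ≈⟨ +-cong (*-cong IH₁′ (≈-refl {1# - W})) (*-cong (≈-refl {W * (1# - Z)}) IH₀′) ⟩
      P m * (1# - W) + W * (1# - Z) * P m
        ≈⟨ solve 3 (λ f w z → f :* (con 1₃ :- w) :+ w :* (con 1₃ :- z) :* f := f :* (con 1₃ :- w :* z)) ≈-refl (P m) W Z ⟩
      P m * (1# - W * Z)
        ≈⟨ *-cong (≈-refl {P m}) (+-cong (≈-refl {1#}) (-‿cong W*Z≈Q^[1+m])) ⟩
      P m * (1# - Q ^ suc m)
        ≈⟨ ≈-sym (pochhammer-suc Q m) ⟩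
      P (suc m) ∎
      where
      open ≈-Reasoning
      P : ℕ → Series
      P = pochhammer Q
      d : ℕ
      d = m ∸ suc k
      m∸k≡1+d : m ∸ k ≡ suc d
      m∸k≡1+d = ℕ.+-∸-assoc 1 k<m
      a₁ a₀ W Z : Series
      a₁ = gaussian Q m (suc k)
      a₀ = gaussian Q m k
      W  = Q ^ suc d
      Z  = Q ^ suc k
      IH₁′ : a₁ * (P k * (1# - Z)) * P d ≈ P m
      IH₁′ = ≈-trans (*-cong (*-cong (≈-refl {a₁}) (≈-sym (pochhammer-suc Q k))) (≈-refl {P d})) IH₁
      IH₀′ : a₀ * P k * (P d * (1# - W)) ≈ P m
      IH₀′ = ≈-trans (*-cong (≈-refl {a₀ * P k}) (≈-trans (≈-sym (pochhammer-suc Q d)) (≈-reflexive (cong P (sym m∸k≡1+d))))) IH₀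
      W*Z≈Q^[1+m] : W * Z ≈ Q ^ suc m
      W*Z≈Q^[1+m] = ≈-trans (≈-sym (^-distribˡ-+-* Q (suc d) (suc k))) (^-≡ Q exponents)
        where
        exponents : suc d +ℕ suc k ≡ suc m
        exponents = trans (cong suc (ℕ.+-comm d (suc k))) (cong suc (ℕ.m+[n∸m]≡n k<m))

  gaussian-pochhammer : ∀ Q m k → k ≤ m →
    gaussian Q m k * pochhammer Q k * pochhammer Q (m ∸ k) ≈ pochhammer Q m
  gaussian-pochhammer Q m zero _ =
    ≈-trans (*-cong (*-cong (gaussian-0 Q m) (≈-refl {1#})) (≈-refl {pochhammer Q m})) (≈-trans (*-cong (*-identityˡ 1#) ≈-refl) (*-identityˡ _))
  gaussian-pochhammer Q (suc m) (suc k) (s≤s k≤m) with ℕ.m≤n⇒m<n∨m≡n k≤m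
  ... | inj₁ k<m  = pochhammer-pascal Q m k k<m (gaussian-pochhammer Q m (suc k) k<m) (gaussian-pochhammer Q m k k≤m)
  ... | inj₂ refl = ≈-trans (*-cong (*-cong (gaussian-diagonal Q (suc k)) (≈-refl {pochhammer Q (suc k)})) (≈-reflexive (cong (pochhammer Q) (ℕ.n∸n≡0 k))))
    (≈-trans (*-cong (*-identityˡ (pochhammer Q (suc k))) ≈-refl) (*-identityʳ (pochhammer Q (suc k))))

-- Exponents in the finite Jacobi triple product with parameters q^α, q^β (s = α + β), where the
-- q-binomial theorem is applied to ∏_{t < 2n} (X + q^(s t)) with X = q^(xe n′), n = n′ + 1.
module TripleProductExponents (α β : ℕ) where
  open import Data.Nat.Base using (ℕ; suc; _+_; _*_; _∸_; _≤_)
  import Data.Nat.Properties as ℕ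
  open import Data.Nat.Tactic.RingSolver using (solve-∀)
  open import Relation.Binary.PropositionalEquality using (_≡_; sym; trans; cong; cong₂; subst; module ≡-Reasoning)
  open TriangularNumbers
  open ≡-Reasoning

  s : ℕ
  s = α + β

  θ₊ θ₋ : ℕ → ℕ
  θ₊ j = α * triangle (suc j) + β * triangle j
  θ₋ j = α * triangle (suc j) + β * triangle (suc (suc j))

  xe : ℕ → ℕ
  xe n′ = s * n′ + β

  E : ℕ → ℕ
  E n′ = s * triangle (suc n′) + suc n′ * xe n′

  xe+α : ∀ n′ → xe n′ + α ≡ s * suc n′
  xe+α n′ = lemma α β n′
    where
    lemma : ∀ α β n′ → (α + β) * n′ + β + α ≡ (α + β) * suc n′
    lemma = solve-∀

  lower-factor-exponent : ∀ n′ t → t ≤ n′ → s * t + (β + s * (n′ ∸ t)) ≡ xe n′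
  lower-factor-exponent n′ t t≤n′ = begin
    s * t + (β + s * (n′ ∸ t))  ≡⟨ rearrange s β t (n′ ∸ t) ⟩
    s * (t + (n′ ∸ t)) + β      ≡⟨ cong (λ m → s * m + β) (ℕ.m+[n∸m]≡n t≤n′) ⟩
    xe n′                        ∎
    where
    rearrange : ∀ s β t u → s * t + (β + s * u) ≡ s * (t + u) + β
    rearrange = solve-∀

  upper-factor-exponent : ∀ n′ t → xe n′ + (α + s * t) ≡ s * (suc n′ + t)
  upper-factor-exponent n′ t = lemma α β n′ t
    where
    lemma : ∀ α β n′ t → (α + β) * n′ + β + (α + (α + β) * t) ≡ (α + β) * (suc n′ + t)
    lemma = solve-∀

  upper-exponent : ∀ n′ j → j ≤ suc n′ →
    s * triangle (suc n′ + j) + xe n′ * ((suc n′ + suc n′) ∸ (suc n′ + j)) ≡ E n′ + θ₊ j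
  upper-exponent n′ j j≤n = begin
    s * triangle (n + j) + xe n′ * ((n + n) ∸ (n + j))
      ≡⟨ cong₂ (λ t d → s * t + xe n′ * d) (triangle-+ n j) (ℕ.[m+n]∸[m+o]≡n∸o n n j) ⟩
    s * (triangle n + triangle j + n * j) + xe n′ * d
      ≡⟨ expand α β (xe n′) n j d (triangle n) (triangle j) ⟩
    s * triangle n + s * triangle j + (s * n) * j + xe n′ * d
      ≡⟨ cong (λ x → s * triangle n + s * triangle j + x * j + xe n′ * d) (sym (xe+α n′)) ⟩
    s * triangle n + s * triangle j + (xe n′ + α) * j + xe n′ * d
      ≡⟨ collect α β (xe n′) j d (triangle n) (triangle j) ⟩
    s * triangle n + (j + d) * xe n′ + θ₊ j
      ≡⟨ cong (λ m → s * triangle n + m * xe n′ + θ₊ j) (ℕ.m+[n∸m]≡n j≤n) ⟩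
    E n′ + θ₊ j ∎
    where
    n d : ℕ
    n = suc n′
    d = n ∸ j
    expand : ∀ α β x n j d tn tj → (α + β) * (tn + tj + n * j) + x * d ≡ (α + β) * tn + (α + β) * tj + ((α + β) * n) * j + x * d
    expand = solve-∀
    collect : ∀ α β x j d tn tj →
      (α + β) * tn + (α + β) * tj + (x + α) * j + x * d ≡ (α + β) * tn + (j + d) * x + (α * (j + tj) + β * tj)
    collect = solve-∀

  lower-exponent : ∀ n′ j → j ≤ n′ →
    s * triangle (n′ ∸ j) + xe n′ * ((suc n′ + suc n′) ∸ (n′ ∸ j)) ≡ E n′ + θ₋ j
  lower-exponent n′ j j≤n′ = subst Goal (ℕ.m+[n∸m]≡n j≤n′) (at (n′ ∸ j))
    where
    Goal : ℕ → Set
    Goal z = s * triangle (n′ ∸ j) + xe z * ((suc z + suc z) ∸ (n′ ∸ j)) ≡ E z + θ₋ j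
    key : ∀ α β j d tj td →
      (α + β) * td + ((α + β) * (j + d) + β) * (suc (j + d) + suc j) + (α + β) * (2 * tj + j)
      ≡ (α + β) * (j + d + (tj + td + j * d)) + suc (j + d) * ((α + β) * (j + d) + β)
        + (α * (j + tj) + β * (suc j + (j + tj))) + (α + β) * (j * j)
    key = solve-∀
    -- After adding s · j² to both sides and writing j² as 2 · triangle j + j, the identity is polynomial.
    at : ∀ d → s * triangle d + xe (j + d) * ((suc (j + d) + suc (j + d)) ∸ d) ≡ E (j + d) + θ₋ j
    at d = ℕ.+-cancelʳ-≡ (s * (j * j)) _ _ (begin
      s * triangle d + xe (j + d) * ((suc (j + d) + suc (j + d)) ∸ d) + s * (j * j)
        ≡⟨ cong₂ (λ m sq → s * triangle d + xe (j + d) * m + s * sq) remaining (sym (2*triangle+id j)) ⟩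
      s * triangle d + xe (j + d) * (suc (j + d) + suc j) + s * (2 * triangle j + j)
        ≡⟨ key α β j d (triangle j) (triangle d) ⟩
      s * (j + d + (triangle j + triangle d + j * d)) + suc (j + d) * xe (j + d) + θ₋ j + s * (j * j)
        ≡⟨ cong (λ t → s * (j + d + t) + suc (j + d) * xe (j + d) + θ₋ j + s * (j * j)) (sym (triangle-+ j d)) ⟩
      E (j + d) + θ₋ j + s * (j * j) ∎)
      where
      remaining : (suc (j + d) + suc (j + d)) ∸ d ≡ suc (j + d) + suc j
      remaining = trans (ℕ.+-∸-assoc (suc (j + d)) (ℕ.≤-trans (ℕ.m≤n+m d j) (ℕ.n≤1+n _)))
        (cong (suc (j + d) +_) (ℕ.m+n∸n≡m (suc j) d))

module TripleProduct where
  open QBinomial public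
  open import Data.Nat.Base using (ℕ; zero; suc; _<_; _≤_; _∸_; s≤s; NonZero) renaming (_+_ to _+ℕ_; _*_ to _*ℕ_)
  import Data.Nat.Properties as ℕ
  open import Data.Nat.Tactic.RingSolver using (solve-∀)
  open import Relation.Binary.PropositionalEquality using (_≡_; refl; sym; trans; cong)
  open Solver using (solve; _:=_; _:*_; _:+_)

  ∏<-q^-* : ∀ c n → ∏[< n ] (λ t → q^ (c *ℕ t)) ≈ q^ (c *ℕ triangle n)
  ∏<-q^-* c zero    = ≈-reflexive (cong q^_ (sym (ℕ.*-zeroʳ c)))
  ∏<-q^-* c (suc n) = ≈-trans (∏.<-snoc (λ t → q^ (c *ℕ t)) n)
    (≈-trans (*-cong (∏<-q^-* c n) (≈-refl {q^ (c *ℕ n)}))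
      (≈-trans (q^-*-q^ (c *ℕ triangle n) (c *ℕ n)) (≈-reflexive (cong q^_ (exponent c n (triangle n))))))
    where
    exponent : ∀ c n t → c *ℕ t +ℕ c *ℕ n ≡ c *ℕ (n +ℕ t)
    exponent = solve-∀

  q^-*-1+q^ : ∀ a c → q^ a * (1# + q^ c) ≈ q^ a + q^ (a +ℕ c)
  q^-*-1+q^ a c = ≈-trans (*-distribˡ-+ (q^ a) 1# (q^ c)) (+-cong (*-identityʳ (q^ a)) (q^-*-q^ a c))

  -- Both sides of the q-binomial theorem for ∏_{t < 2n} (X + Q^t), Q = q^s, X = q^(xe n′), are
  -- q^(E n′) times the two sides of the finite triple product.
  module FiniteTripleProduct (α β n′ : ℕ) where
    open TripleProductExponents α β

    n m : ℕ
    n = suc n′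
    m = n +ℕ n

    Q X : Series
    Q = q^ s
    X = q^ xe n′

    B : ℕ → Series
    B c = ∏[< n ] (λ t → 1# + q^ (c +ℕ s *ℕ t))

    lower-half : ∏[< n ] (λ t → X + Q ^ t) ≈ q^ (s *ℕ triangle n) * B β
    lower-half = begin
      ∏[< n ] (λ t → X + Q ^ t)
        ≈⟨ ∏.<-cong n factor ⟩
      ∏[< n ] (λ t → q^ (s *ℕ t) * (1# + q^ (β +ℕ s *ℕ (n′ ∸ t))))
        ≈⟨ ≈-sym (∏.<-merge (λ t → q^ (s *ℕ t)) (λ t → 1# + q^ (β +ℕ s *ℕ (n′ ∸ t))) n) ⟩
      ∏[< n ] (λ t → q^ (s *ℕ t)) * ∏[< n ] (λ t → 1# + q^ (β +ℕ s *ℕ (n′ ∸ t)))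
        ≈⟨ *-cong (∏<-q^-* s n) (≈-sym (∏.<-reverse (λ t → 1# + q^ (β +ℕ s *ℕ t)) n)) ⟩
      q^ (s *ℕ triangle n) * B β ∎
      where
      open ≈-Reasoning
      factor : ∀ t → t < n → X + Q ^ t ≈ q^ (s *ℕ t) * (1# + q^ (β +ℕ s *ℕ (n′ ∸ t)))
      factor t (s≤s t≤n′) = ≈-trans
        (+-cong (≈-reflexive (cong q^_ (sym (lower-factor-exponent n′ t t≤n′)))) (q^-^ s t))
        (≈-trans (+-comm (q^ (s *ℕ t +ℕ (β +ℕ s *ℕ (n′ ∸ t)))) (q^ (s *ℕ t)))
          (≈-sym (q^-*-1+q^ (s *ℕ t) (β +ℕ s *ℕ (n′ ∸ t)))))

    upper-half : ∏[< n ] (λ t → X + Q ^ (n +ℕ t)) ≈ q^ (n *ℕ xe n′) * B α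
    upper-half = begin
      ∏[< n ] (λ t → X + Q ^ (n +ℕ t))            ≈⟨ ∏.<-cong n (λ t _ → factor t) ⟩
      ∏[< n ] (λ t → X * (1# + q^ (α +ℕ s *ℕ t)))  ≈⟨ ≈-sym (∏.<-merge (λ _ → X) (λ t → 1# + q^ (α +ℕ s *ℕ t)) n) ⟩
      ∏[< n ] (λ _ → X) * B α                      ≈⟨ *-cong Xⁿ (≈-refl {B α}) ⟩
      q^ (n *ℕ xe n′) * B α                         ∎
      where
      open ≈-Reasoning
      factor : ∀ t → X + Q ^ (n +ℕ t) ≈ X * (1# + q^ (α +ℕ s *ℕ t))
      factor t = ≈-trans
        (+-cong (≈-refl {X}) (≈-trans (q^-^ s (n +ℕ t)) (≈-reflexive (cong q^_ (sym (upper-factor-exponent n′ t))))))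
        (≈-sym (q^-*-1+q^ (xe n′) (α +ℕ s *ℕ t)))
      Xⁿ : ∏[< n ] (λ _ → X) ≈ q^ (n *ℕ xe n′)
      Xⁿ = ≈-trans (∏<-const X n) (≈-trans (q^-^ (xe n′) n) (≈-reflexive (cong q^_ (ℕ.*-comm (xe n′) n))))

    product-side : ∏[< m ] (λ t → X + Q ^ t) ≈ q^ (E n′) * (B β * B α)
    product-side = begin
      ∏[< m ] (λ t → X + Q ^ t)
        ≈⟨ ∏.<-split (λ t → X + Q ^ t) n n ⟩
      ∏[< n ] (λ t → X + Q ^ t) * ∏[< n ] (λ t → X + Q ^ (n +ℕ t))
        ≈⟨ *-cong lower-half upper-half ⟩
      q^ (s *ℕ triangle n) * B β * (q^ (n *ℕ xe n′) * B α)
        ≈⟨ solve 4 (λ a b c d → a :* b :* (c :* d) := (a :* c) :* (b :* d)) ≈-refl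
                   (q^ (s *ℕ triangle n)) (B β) (q^ (n *ℕ xe n′)) (B α) ⟩
      (q^ (s *ℕ triangle n) * q^ (n *ℕ xe n′)) * (B β * B α)
        ≈⟨ *-cong (q^-*-q^ (s *ℕ triangle n) (n *ℕ xe n′)) (≈-refl {B β * B α}) ⟩
      q^ (E n′) * (B β * B α) ∎
      where open ≈-Reasoning

    term : ℕ → Series
    term k = gaussian Q m k * Q ^ triangle k * X ^ (m ∸ k)

    S₊ S₋ : Series
    S₊ = ∑[< suc n ] (λ j → gaussian Q m (n +ℕ j) * q^ θ₊ j)
    S₋ = ∑[< n ] (λ j → gaussian Q m (n ∸ suc j) * q^ θ₋ j)

    term-q^ : ∀ k e → s *ℕ triangle k +ℕ xe n′ *ℕ (m ∸ k) ≡ E n′ +ℕ e → term k ≈ q^ (E n′) * (gaussian Q m k * q^ e)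
    term-q^ k e exponents = begin
      gaussian Q m k * Q ^ triangle k * X ^ (m ∸ k)
        ≈⟨ *-assoc (gaussian Q m k) (Q ^ triangle k) (X ^ (m ∸ k)) ⟩
      gaussian Q m k * (Q ^ triangle k * X ^ (m ∸ k))
        ≈⟨ *-cong (≈-refl {gaussian Q m k}) (≈-trans (*-cong (q^-^ s (triangle k)) (q^-^ (xe n′) (m ∸ k)))
                                                      (q^-*-q^ (s *ℕ triangle k) (xe n′ *ℕ (m ∸ k)))) ⟩
      gaussian Q m k * q^ (s *ℕ triangle k +ℕ xe n′ *ℕ (m ∸ k))
        ≈⟨ *-cong (≈-refl {gaussian Q m k}) (≈-trans (≈-reflexive (cong q^_ exponents)) (≈-sym (q^-*-q^ (E n′) e))) ⟩
      gaussian Q m k * (q^ (E n′) * q^ e)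
        ≈⟨ solve 3 (λ a b c → a :* (b :* c) := b :* (a :* c)) ≈-refl (gaussian Q m k) (q^ (E n′)) (q^ e) ⟩
      q^ (E n′) * (gaussian Q m k * q^ e) ∎
      where open ≈-Reasoning

    sum-side : ∑[< suc m ] term ≈ q^ (E n′) * (S₊ + S₋)
    sum-side = begin
      ∑[< suc m ] term
        ≈⟨ ≈-reflexive (cong (λ k → ∑[< k ] term) (sym (ℕ.+-suc n n))) ⟩
      ∑[< n +ℕ suc n ] term
        ≈⟨ ∑.<-split term n (suc n) ⟩
      ∑[< n ] term + ∑[< suc n ] (λ j → term (n +ℕ j))
        ≈⟨ +-cong (∑.<-reverse term n) (≈-refl {∑[< suc n ] (λ j → term (n +ℕ j))}) ⟩
      ∑[< n ] (λ j → term (n ∸ suc j)) + ∑[< suc n ] (λ j → term (n +ℕ j))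
        ≈⟨ +-cong (∑.<-cong n lower-terms) (∑.<-cong (suc n) upper-terms) ⟩
      ∑[< n ] (λ j → q^ (E n′) * (gaussian Q m (n ∸ suc j) * q^ θ₋ j))
        + ∑[< suc n ] (λ j → q^ (E n′) * (gaussian Q m (n +ℕ j) * q^ θ₊ j))
        ≈⟨ +-cong (≈-sym (∑<-*ˡ (q^ (E n′)) (λ j → gaussian Q m (n ∸ suc j) * q^ θ₋ j) n))
                  (≈-sym (∑<-*ˡ (q^ (E n′)) (λ j → gaussian Q m (n +ℕ j) * q^ θ₊ j) (suc n))) ⟩
      q^ (E n′) * S₋ + q^ (E n′) * S₊
        ≈⟨ solve 3 (λ a x y → a :* x :+ a :* y := a :* (y :+ x)) ≈-refl (q^ (E n′)) S₋ S₊ ⟩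
      q^ (E n′) * (S₊ + S₋) ∎
      where
      open ≈-Reasoning
      upper-terms : ∀ j → j < suc n → term (n +ℕ j) ≈ q^ (E n′) * (gaussian Q m (n +ℕ j) * q^ θ₊ j)
      upper-terms j (s≤s j≤n) = term-q^ (n +ℕ j) (θ₊ j) (upper-exponent n′ j j≤n)
      lower-terms : ∀ j → j < n → term (n ∸ suc j) ≈ q^ (E n′) * (gaussian Q m (n ∸ suc j) * q^ θ₋ j)
      lower-terms j (s≤s j≤n′) = term-q^ (n ∸ suc j) (θ₋ j) (lower-exponent n′ j j≤n′)

    finite-triple-product : B β * B α ≈ S₊ + S₋
    finite-triple-product =
      q^-*-cancelˡ (E n′) (≈-trans (≈-sym product-side) (≈-trans (q-binomial Q X m) sum-side))

  ∑q^ : (ℕ → ℕ) → Series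
  ∑q^ e = ∑ (λ j → q^ e j)

  ∑q^-summable : ∀ {e : ℕ → ℕ} → (∀ j → j ≤ e j) → Summable (λ j → q^ e j)
  ∑q^-summable {e} j≤e j = q^-≈[]-0# (e j) j (j≤e j)

  -- Ramanujan's theta function f(q^α, q^β)
  θ : ℕ → ℕ → Series
  θ α β = ∑q^ θ₊ + ∑q^ θ₋
    where open TripleProductExponents α β

  -- Multiplying the finite identity by (Q; Q)∞ makes every Gaussian coefficient [2n, k] ≡ 1
  -- modulo q^(min(k, 2n - k) + 1), so that it approximates the infinite identity modulo q^(n + 1).
  module Limit (α′ β′ : ℕ) where
    α β : ℕ
    α = suc α′
    β = suc β′
    open TripleProductExponents α β

    Q : Series
    Q = q^ s

    euler : Series
    euler = ∏ (λ t → 1# - Q ^ suc t)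

    euler-factor-≈[] : ∀ t → 1# - Q ^ suc t ≈[ s *ℕ suc t ] 1#
    euler-factor-≈[] t = 1#--≈[] (s *ℕ suc t)
      (λ i i<K → trans (q^-^ s (suc t) i) (q^-≈[]-0# (s *ℕ suc t) (s *ℕ suc t) ℕ.≤-refl i i<K))

    euler-multipliable : Multipliable (λ t → 1# - Q ^ suc t)
    euler-multipliable t = ≈[]-weaken (ℕ.≤-trans (ℕ.n≤1+n t) (ℕ.m≤n*m (suc t) s)) (euler-factor-≈[] t)

    pochhammer-≈[] : ∀ j K → K ≤ suc j → pochhammer Q j ≈[ K ] euler
    pochhammer-≈[] j K K≤1+j = ≈[]-sym K (∏.≈[]-< j K euler-multipliable
      (λ k j≤k → ≈[]-weaken (ℕ.≤-trans K≤1+j (ℕ.≤-trans (s≤s j≤k) (ℕ.m≤n*m (suc k) s))) (euler-factor-≈[] k)))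

    gaussian-euler-≈[] : ∀ m k K → k ≤ m → K ≤ suc k → K ≤ suc (m ∸ k) → gaussian Q m k * euler ≈[ K ] 1#
    gaussian-euler-≈[] m k K k≤m K≤1+k K≤1+m∸k = *-cancelˡ-≈[] K refl (begin
      euler * (g * euler)
        ≈⟨ ≈⇒≈[] K (solve 2 (λ f g → f :* (g :* f) := g :* f :* f) ≈-refl euler g) ⟩
      g * euler * euler
        ≈⟨ *-cong-≈[] K (*-cong-≈[] K (≈[]-refl K) (≈[]-sym K (pochhammer-≈[] k K K≤1+k)))
                        (≈[]-sym K (pochhammer-≈[] (m ∸ k) K K≤1+m∸k)) ⟩
      g * pochhammer Q k * pochhammer Q (m ∸ k)
        ≈⟨ ≈⇒≈[] K (gaussian-pochhammer Q m k k≤m) ⟩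
      pochhammer Q m
        ≈⟨ pochhammer-≈[] m K (ℕ.≤-trans K≤1+k (s≤s k≤m)) ⟩
      euler
        ≈⟨ ≈⇒≈[] K (≈-sym (*-identityʳ euler)) ⟩
      euler * 1# ∎)
      where
      open ≈[]-Reasoning K
      g : Series
      g = gaussian Q m k

    gaussian-term-≈[] : ∀ {m k} c e K → k ≤ m → c ≤ k → c ≤ m ∸ k → K ≤ e +ℕ suc c →
      euler * (gaussian Q m k * q^ e) ≈[ K ] q^ e
    gaussian-term-≈[] {m} {k} c e K k≤m c≤k c≤m∸k K≤e+1+c = begin
      euler * (gaussian Q m k * q^ e)
        ≈⟨ ≈⇒≈[] K (≈-trans (solve 3 (λ f g x → f :* (g :* x) := x :* (g :* f)) ≈-refl euler (gaussian Q m k) (q^ e))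
                             (q^-* e (gaussian Q m k * euler))) ⟩
      shiftBy e (gaussian Q m k * euler)
        ≈⟨ ≈[]-weaken K≤e+1+c (shiftBy-≈[] e (suc c) (gaussian-euler-≈[] m k (suc c) k≤m (s≤s c≤k) (s≤s c≤m∸k))) ⟩
      q^ e ∎
      where open ≈[]-Reasoning K

    pair : ℕ → Series
    pair t = (1# + q^ (β +ℕ s *ℕ t)) * (1# + q^ (α +ℕ s *ℕ t))

    pair-≈[] : ∀ t K → K ≤ suc t → pair t ≈[ K ] 1#
    pair-≈[] t K K≤1+t = *-≈[]-1# K (factor β′) (factor α′)
      where
      factor : ∀ c′ → 1# + q^ (suc c′ +ℕ s *ℕ t) ≈[ K ] 1#
      factor c′ = 1#+-≈[] K (q^-≈[]-0# (suc c′ +ℕ s *ℕ t) K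
        (ℕ.≤-trans K≤1+t (s≤s (ℕ.≤-trans (ℕ.m≤n*m t s) (ℕ.m≤n+m (s *ℕ t) c′)))))

    pair-multipliable : Multipliable pair
    pair-multipliable t = pair-≈[] t t (ℕ.n≤1+n t)

    θ₊-≥ : ∀ j → j ≤ θ₊ j
    θ₊-≥ j = ℕ.≤-trans (ℕ.m≤m+n j (triangle j))
      (ℕ.≤-trans (ℕ.m≤n*m (triangle (suc j)) α) (ℕ.m≤m+n (α *ℕ triangle (suc j)) (β *ℕ triangle j)))

    θ₋-≥ : ∀ j → suc j ≤ θ₋ j
    θ₋-≥ j = ℕ.≤-trans (ℕ.m≤m+n (suc j) (triangle (suc j)))
      (ℕ.≤-trans (ℕ.m≤n*m (triangle (suc (suc j))) β) (ℕ.m≤n+m (β *ℕ triangle (suc (suc j))) (α *ℕ triangle (suc j))))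

    θ₊-summable : Summable (λ j → q^ θ₊ j)
    θ₊-summable = ∑q^-summable θ₊-≥

    θ₋-summable : Summable (λ j → q^ θ₋ j)
    θ₋-summable = ∑q^-summable (λ j → ℕ.≤-trans (ℕ.n≤1+n j) (θ₋-≥ j))

    module Approximation (n′ : ℕ) where
      open FiniteTripleProduct α β n′ using (n; m; S₊; S₋; finite-triple-product)

      K : ℕ
      K = suc n

      upper-sum : euler * S₊ ≈[ K ] ∑[< suc n ] (λ j → q^ θ₊ j)
      upper-sum = ≈[]-trans K (≈⇒≈[] K (∑<-*ˡ euler (λ j → gaussian Q m (n +ℕ j) * q^ θ₊ j) (suc n)))
        (∑.<-cong-≈[] K (suc n) term)
        where
        term : ∀ j → j < suc n → euler * (gaussian Q m (n +ℕ j) * q^ θ₊ j) ≈[ K ] q^ θ₊ j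
        term j (s≤s j≤n) = gaussian-term-≈[] (n ∸ j) (θ₊ j) K (ℕ.+-monoʳ-≤ n j≤n)
          (ℕ.≤-trans (ℕ.m∸n≤m n j) (ℕ.m≤m+n n j)) (ℕ.≤-reflexive (sym (ℕ.[m+n]∸[m+o]≡n∸o n n j)))
          (ℕ.≤-trans (ℕ.≤-reflexive (trans (cong suc (sym (ℕ.m+[n∸m]≡n j≤n))) (sym (ℕ.+-suc j (n ∸ j)))))
                     (ℕ.+-monoˡ-≤ (suc (n ∸ j)) (θ₊-≥ j)))

      lower-sum : euler * S₋ ≈[ K ] ∑[< n ] (λ j → q^ θ₋ j)
      lower-sum = ≈[]-trans K (≈⇒≈[] K (∑<-*ˡ euler (λ j → gaussian Q m (n ∸ suc j) * q^ θ₋ j) n))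
        (∑.<-cong-≈[] K n term)
        where
        term : ∀ j → j < n → euler * (gaussian Q m (n ∸ suc j) * q^ θ₋ j) ≈[ K ] q^ θ₋ j
        term j (s≤s j≤n′) = gaussian-term-≈[] (n′ ∸ j) (θ₋ j) K k≤m ℕ.≤-refl
          (ℕ.m+n≤o⇒m≤o∸n (n′ ∸ j) (ℕ.≤-trans (ℕ.+-mono-≤ k≤n′ k≤n′) (ℕ.+-mono-≤ (ℕ.n≤1+n n′) (ℕ.n≤1+n n′))))
          (ℕ.≤-trans (ℕ.≤-reflexive (trans (cong (λ x → suc (suc x)) (sym (ℕ.m+[n∸m]≡n j≤n′)))
                                           (cong suc (sym (ℕ.+-suc j (n′ ∸ j))))))
                     (ℕ.+-monoˡ-≤ (suc (n′ ∸ j)) (θ₋-≥ j)))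
          where
          k≤n′ : n′ ∸ j ≤ n′
          k≤n′ = ℕ.m∸n≤m n′ j
          k≤m : n′ ∸ j ≤ m
          k≤m = ℕ.≤-trans k≤n′ (ℕ.≤-trans (ℕ.n≤1+n n′) (ℕ.m≤m+n n n))

      θ-≈[] : θ α β ≈[ K ] ∑[< suc n ] (λ j → q^ θ₊ j) + ∑[< n ] (λ j → q^ θ₋ j)
      θ-≈[] = +-cong-≈[] K (∑.≈[]-<-self K θ₊-summable)
        (∑.≈[]-< n K θ₋-summable (λ k n≤k → q^-≈[]-0# (θ₋ k) K (ℕ.≤-trans (s≤s n≤k) (θ₋-≥ k))))

      approximation : euler * ∏ pair ≈[ K ] θ α β
      approximation = begin
        euler * ∏ pair
          ≈⟨ *-cong-≈[] K (≈[]-refl K) (∏.≈[]-< n K pair-multipliable (λ k n≤k → pair-≈[] k K (s≤s n≤k))) ⟩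
        euler * ∏[< n ] pair
          ≈⟨ ≈⇒≈[] K (*-cong (≈-refl {euler}) (≈-trans (≈-sym (∏.<-merge (λ t → 1# + q^ (β +ℕ s *ℕ t)) (λ t → 1# + q^ (α +ℕ s *ℕ t)) n))
                                                        finite-triple-product)) ⟩
        euler * (S₊ + S₋)
          ≈⟨ ≈⇒≈[] K (*-distribˡ-+ euler S₊ S₋) ⟩
        euler * S₊ + euler * S₋
          ≈⟨ +-cong-≈[] K upper-sum lower-sum ⟩
        ∑[< suc n ] (λ j → q^ θ₊ j) + ∑[< n ] (λ j → q^ θ₋ j)
          ≈⟨ ≈[]-sym K θ-≈[] ⟩
        θ α β ∎
        where open ≈[]-Reasoning K

    triple-product : euler * ∏ pair ≈ θ α β
    triple-product = ≈[]⇒≈ (λ K → ≈[]-weaken (ℕ.≤-trans (ℕ.n≤1+n K) (ℕ.n≤1+n (suc K))) (Approximation.approximation K))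

  jacobi-triple-product : ∀ α β → .{{_ : NonZero α}} → .{{_ : NonZero β}} →
    ∏ (λ t → 1# - q^ (α +ℕ β) ^ suc t) * ∏ (λ t → (1# + q^ (β +ℕ (α +ℕ β) *ℕ t)) * (1# + q^ (α +ℕ (α +ℕ β) *ℕ t)))
    ≈ θ α β
  jacobi-triple-product (suc α′) (suc β′) = Limit.triple-product α′ β′

module EtaProducts where
  open TripleProduct public
  open import Data.Nat.Base using (ℕ; suc; NonZero) renaming (_+_ to _+ℕ_; _*_ to _*ℕ_)
  import Data.Nat.Properties as ℕ
  open import Data.Product.Base using (_×_; _,_)
  open import Relation.Binary.PropositionalEquality using (_≡_; sym; trans; cong; cong₂)
  open Solver using (solve; _:=_; _:*_; _:+_; _:-_; con)

  -- 1 / (1 - q^k), a junk value for k = 0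
  geometric : ℕ → Series
  geometric k = ∑ (λ i → q^ (k *ℕ i))

  module _ (k : ℕ) .{{_ : NonZero k}} where

    geometric-summable : Summable (λ i → q^ (k *ℕ i))
    geometric-summable i = q^-≈[]-0# (k *ℕ i) i (ℕ.m≤n*m i k)

    geometric-unfold : geometric k ≈ 1# + q^ k * geometric k
    geometric-unfold = begin
      geometric k                                             ≈⟨ ∑.unfold geometric-summable ⟩
      q^ (k *ℕ 0) + ∑ (λ i → q^ (k *ℕ suc i))                 ≈⟨ +-cong (≈-reflexive (cong q^_ (ℕ.*-zeroʳ k))) (∑.cong shifted) ⟩
      1# + ∑ (λ i → shiftBy k (q^ (k *ℕ i)))                  ≈⟨ +-cong (≈-refl {1#}) (∑-shiftBy k geometric-summable) ⟩
      1# + shiftBy k (geometric k)                            ≈⟨ +-cong (≈-refl {1#}) (≈-sym (q^-* k (geometric k))) ⟩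
      1# + q^ k * geometric k                                 ∎
      where
      open ≈-Reasoning
      shifted : ∀ i → q^ (k *ℕ suc i) ≈ shiftBy k (q^ (k *ℕ i))
      shifted i = ≈-trans (≈-reflexive (cong q^_ (ℕ.*-suc k i))) (≈-sym (shiftBy-+-shiftBy k (k *ℕ i) 1#))

    1-q^-*-geometric : (1# - q^ k) * geometric k ≈ 1#
    1-q^-*-geometric = begin
      (1# - q^ k) * geometric k             ≈⟨ solve 2 (λ m g → (con 1₃ :- m) :* g := g :- m :* g) ≈-refl (q^ k) (geometric k) ⟩
      geometric k - q^ k * geometric k      ≈⟨ +-cong geometric-unfold (≈-refl { - (q^ k * geometric k)}) ⟩
      1# + q^ k * geometric k - q^ k * geometric k ≈⟨ solve 2 (λ m g → con 1₃ :+ m :* g :- m :* g := con 1₃) ≈-refl (q^ k) (geometric k) ⟩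
      1#                                    ∎
      where open ≈-Reasoning

    geometric-≈[] : geometric k ≈[ k ] 1#
    geometric-≈[] i i<k = trans (geometric-unfold i)
      (trans (cong (1# i +₃_) (trans (q^-* k (geometric k) i) (shiftBy-below k (geometric k) i i<k))) (+₃-identityʳ (1# i)))

  1-q^-≈[] : ∀ k → 1# - q^ k ≈[ k ] 1#
  1-q^-≈[] k = 1#--≈[] k (q^-≈[]-0# k k ℕ.≤-refl)

  dilate-1-q^ : ∀ k → dilate (1# - q^ k) ≈ 1# - q^ (3 *ℕ k)
  dilate-1-q^ k = ≈-trans (dilate-+ 1# (- q^ k)) (+-cong dilate-1# (≈-trans (dilate-- (q^ k)) (-‿cong (dilate-q^ k))))

  dilate-geometric : ∀ k .{{_ : NonZero k}} → dilate (geometric k) ≈ geometric (3 *ℕ k)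
  dilate-geometric k = ≈-trans (≈-sym (∑-dilate (geometric-summable k)))
    (∑.cong (λ i → ≈-trans (dilate-q^ (k *ℕ i)) (≈-reflexive (cong q^_ (sym (ℕ.*-assoc 3 k i))))))

  -- (1 - q^k)^(a - b)
  etaFactor : ℕ → ℕ → ℕ → Series
  etaFactor k a b = (1# - q^ k) ^ a * geometric k ^ b

  -- ∏_{k ≥ 1} (1 - q^k)^(a k - b k)
  etaQuotient : (ℕ → ℕ) → (ℕ → ℕ) → Series
  etaQuotient a b = ∏ (λ i → etaFactor (suc i) (a (suc i)) (b (suc i)))

  etaFactor-≈[] : ∀ k a b .{{_ : NonZero k}} → etaFactor k a b ≈[ k ] 1#
  etaFactor-≈[] k a b = *-≈[]-1# k (^-≈[]-1# k a (1-q^-≈[] k)) (^-≈[]-1# k b (geometric-≈[] k))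

  etaQuotient-multipliable : ∀ (a b : ℕ → ℕ) → Multipliable (λ i → etaFactor (suc i) (a (suc i)) (b (suc i)))
  etaQuotient-multipliable a b i = ≈[]-weaken (ℕ.n≤1+n i) (etaFactor-≈[] (suc i) (a (suc i)) (b (suc i)))

  etaFactor-* : ∀ k a b c d → etaFactor k a b * etaFactor k c d ≈ etaFactor k (a +ℕ c) (b +ℕ d)
  etaFactor-* k a b c d = ≈-trans
    (solve 4 (λ x y z w → (x :* y) :* (z :* w) := (x :* z) :* (y :* w)) ≈-refl
      ((1# - q^ k) ^ a) (geometric k ^ b) ((1# - q^ k) ^ c) (geometric k ^ d))
    (*-cong (≈-sym (^-distribˡ-+-* (1# - q^ k) a c)) (≈-sym (^-distribˡ-+-* (geometric k) b d)))

  etaQuotient-* : ∀ (a b c d : ℕ → ℕ) →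
    etaQuotient a b * etaQuotient c d ≈ etaQuotient (λ k → a k +ℕ c k) (λ k → b k +ℕ d k)
  etaQuotient-* a b c d = ≈-trans (∏.merge (etaQuotient-multipliable a b) (etaQuotient-multipliable c d))
    (∏.cong (λ i → etaFactor-* (suc i) (a (suc i)) (b (suc i)) (c (suc i)) (d (suc i))))

  etaFactor-balance : ∀ k a b m .{{_ : NonZero k}} → etaFactor k a b ≈ etaFactor k (a +ℕ m) (b +ℕ m)
  etaFactor-balance k a b m = begin
    etaFactor k a b                                        ≈⟨ ≈-sym (*-identityʳ (etaFactor k a b)) ⟩
    etaFactor k a b * 1#                                   ≈⟨ *-cong (≈-refl {etaFactor k a b}) (≈-sym one) ⟩
    etaFactor k a b * ((1# - q^ k) ^ m * geometric k ^ m)  ≈⟨ etaFactor-* k a b m m ⟩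
    etaFactor k (a +ℕ m) (b +ℕ m)                          ∎
    where
    open ≈-Reasoning
    one : (1# - q^ k) ^ m * geometric k ^ m ≈ 1#
    one = ≈-trans (≈-sym (^-distribʳ-* (1# - q^ k) (geometric k) m)) (≈-trans (^-cong m (1-q^-*-geometric k)) (1#-^ m))

  etaFactor-cong : ∀ k a b a′ b′ .{{_ : NonZero k}} → b′ +ℕ a ≡ b +ℕ a′ → etaFactor k a b ≈ etaFactor k a′ b′
  etaFactor-cong k a b a′ b′ b′+a≡b+a′ = begin
    etaFactor k a b                  ≈⟨ etaFactor-balance k a b b′ ⟩
    etaFactor k (a +ℕ b′) (b +ℕ b′)  ≈⟨ ≈-reflexive (cong₂ (etaFactor k) a+b′≡a′+b (ℕ.+-comm b b′)) ⟩
    etaFactor k (a′ +ℕ b) (b′ +ℕ b)  ≈⟨ ≈-sym (etaFactor-balance k a′ b′ b) ⟩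
    etaFactor k a′ b′                ∎
    where
    open ≈-Reasoning
    a+b′≡a′+b : a +ℕ b′ ≡ a′ +ℕ b
    a+b′≡a′+b = trans (ℕ.+-comm a b′) (trans b′+a≡b+a′ (ℕ.+-comm b a′))

  etaQuotient-cong : ∀ (a b a′ b′ : ℕ → ℕ) → (∀ k → b′ (suc k) +ℕ a (suc k) ≡ b (suc k) +ℕ a′ (suc k)) →
    etaQuotient a b ≈ etaQuotient a′ b′
  etaQuotient-cong a b a′ b′ eq = ∏.cong (λ i → etaFactor-cong (suc i) (a (suc i)) (b (suc i)) (a′ (suc i)) (b′ (suc i)) (eq i))

  etaQuotient-frobenius : ∀ (a b : ℕ → ℕ) → etaQuotient (λ k → a k *ℕ 3) (λ k → b k *ℕ 3) ≈ dilate (etaQuotient a b)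
  etaQuotient-frobenius a b = ≈-trans (∏.cong cube) (∏-dilate (etaQuotient-multipliable a b))
    where
    cube : ∀ i → etaFactor (suc i) (a (suc i) *ℕ 3) (b (suc i) *ℕ 3) ≈ dilate (etaFactor (suc i) (a (suc i)) (b (suc i)))
    cube i = ≈-trans (*-cong (≈-sym (^-*-assoc (1# - q^ suc i) (a (suc i)) 3)) (≈-sym (^-*-assoc (geometric (suc i)) (b (suc i)) 3)))
      (≈-trans (≈-sym (^-distribʳ-* ((1# - q^ suc i) ^ a (suc i)) (geometric (suc i) ^ b (suc i)) 3))
        (frobenius (etaFactor (suc i) (a (suc i)) (b (suc i)))))

  dilate-etaFactor : ∀ k a b .{{_ : NonZero k}} → dilate (etaFactor k a b) ≈ etaFactor (3 *ℕ k) a b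
  dilate-etaFactor k a b = ≈-trans (dilate-* ((1# - q^ k) ^ a) (geometric k ^ b))
    (*-cong (≈-trans (dilate-^ (1# - q^ k) a) (^-cong a (dilate-1-q^ k)))
            (≈-trans (dilate-^ (geometric k) b) (^-cong b (dilate-geometric k))))

  etaQuotient-blocks : ∀ (a b : ℕ → ℕ) p h →
    (∀ t → ∏[< suc p ] (λ r → etaFactor (suc (r +ℕ suc p *ℕ t)) (a (suc (r +ℕ suc p *ℕ t))) (b (suc (r +ℕ suc p *ℕ t)))) ≈ h t) →
    etaQuotient a b ≈ ∏ h
  etaQuotient-blocks a b p h blocks = ∏.blocks h p (etaQuotient-multipliable a b)
    (λ n → ≈-trans (∏.<-chunks (suc p) _ n) (∏.<-cong n (λ t _ → blocks t)))

  -- a′ is the exponent function of the dilated product.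
  _Dilates_ : (ℕ → ℕ) → (ℕ → ℕ) → Set
  a′ Dilates a = ∀ t → a′ (1 +ℕ 3 *ℕ t) ≡ 0 × a′ (2 +ℕ 3 *ℕ t) ≡ 0 × a′ (3 +ℕ 3 *ℕ t) ≡ a (suc t)

  etaQuotient-dilate : ∀ {a b a′ b′} → a′ Dilates a → b′ Dilates b → dilate (etaQuotient a b) ≈ etaQuotient a′ b′
  etaQuotient-dilate {a} {b} {a′} {b′} a′-dilates b′-dilates = begin
    dilate (etaQuotient a b)
      ≈⟨ ≈-sym (∏-dilate (etaQuotient-multipliable a b)) ⟩
    ∏ (λ i → dilate (etaFactor (suc i) (a (suc i)) (b (suc i))))
      ≈⟨ ∏.cong (λ i → dilate-etaFactor (suc i) (a (suc i)) (b (suc i))) ⟩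
    ∏ (λ i → etaFactor (3 *ℕ suc i) (a (suc i)) (b (suc i)))
      ≈⟨ ≈-sym (etaQuotient-blocks a′ b′ 2 _ block) ⟩
    etaQuotient a′ b′ ∎
    where
    open ≈-Reasoning
    block : ∀ t → ∏[< 3 ] (λ r → etaFactor (suc (r +ℕ 3 *ℕ t)) (a′ (suc (r +ℕ 3 *ℕ t))) (b′ (suc (r +ℕ 3 *ℕ t))))
                  ≈ etaFactor (3 *ℕ suc t) (a (suc t)) (b (suc t))
    block t with a′-dilates t | b′-dilates t
    ... | a₁ , a₂ , a₃ | b₁ , b₂ , b₃ = begin
      etaFactor (1 +ℕ 3 *ℕ t) (a′ (1 +ℕ 3 *ℕ t)) (b′ (1 +ℕ 3 *ℕ t))
        * (etaFactor (2 +ℕ 3 *ℕ t) (a′ (2 +ℕ 3 *ℕ t)) (b′ (2 +ℕ 3 *ℕ t))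
        * (etaFactor (3 +ℕ 3 *ℕ t) (a′ (3 +ℕ 3 *ℕ t)) (b′ (3 +ℕ 3 *ℕ t)) * 1#))
        ≈⟨ *-cong (≈-reflexive (cong₂ (etaFactor (1 +ℕ 3 *ℕ t)) a₁ b₁))
             (*-cong (≈-reflexive (cong₂ (etaFactor (2 +ℕ 3 *ℕ t)) a₂ b₂))
               (*-cong (≈-reflexive (cong₂ (etaFactor (3 +ℕ 3 *ℕ t)) a₃ b₃)) (≈-refl {1#}))) ⟩
      etaFactor (1 +ℕ 3 *ℕ t) 0 0 * (etaFactor (2 +ℕ 3 *ℕ t) 0 0 * (etaFactor (3 +ℕ 3 *ℕ t) (a (suc t)) (b (suc t)) * 1#))
        ≈⟨ solve 1 (λ w → con 1₃ :* con 1₃ :* (con 1₃ :* con 1₃ :* (w :* con 1₃)) := w) ≈-refl _ ⟩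
      etaFactor (3 +ℕ 3 *ℕ t) (a (suc t)) (b (suc t))
        ≈⟨ ≈-reflexive (cong (λ k → etaFactor k (a (suc t)) (b (suc t))) (sym (ℕ.*-suc 3 t))) ⟩
      etaFactor (3 *ℕ suc t) (a (suc t)) (b (suc t)) ∎

  Periodic : ℕ → (ℕ → ℕ) → Set
  Periodic m a = ∀ k t → a (k +ℕ m *ℕ t) ≡ a k

  etaQuotient-periodic : ∀ m .{{_ : NonZero m}} (a b : ℕ → ℕ) h → Periodic m a → Periodic m b →
    (∀ t → ∏[< m ] (λ r → etaFactor (suc r +ℕ m *ℕ t) (a (suc r)) (b (suc r))) ≈ h t) →
    etaQuotient a b ≈ ∏ h
  etaQuotient-periodic m@(suc p) a b h a-periodic b-periodic blocks = etaQuotient-blocks a b p h (λ t →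
    ≈-trans (∏.<-cong m (λ r _ → ≈-reflexive (cong₂ (etaFactor (suc r +ℕ m *ℕ t)) (a-periodic (suc r) t) (b-periodic (suc r) t))))
            (blocks t))

module TriangleIdentities where
  open import Data.Nat.Base using (ℕ; zero; suc; _+_; _*_)
  import Data.Nat.Properties as ℕ
  open import Data.Nat.Tactic.RingSolver using (solve-∀)
  open import Relation.Binary.PropositionalEquality using (_≡_; refl; cong; module ≡-Reasoning)
  open TriangularNumbers
  open ≡-Reasoning

  triangle-1+2t : ∀ t → triangle (1 + 2 * t) ≡ 3 * triangle (suc t) + 1 * triangle t
  triangle-1+2t zero    = refl
  triangle-1+2t (suc t) = begin
    triangle (1 + 2 * suc t)                                ≡⟨ cong (λ x → triangle (1 + x)) (ℕ.*-suc 2 t) ⟩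
    (2 + 2 * t) + ((1 + 2 * t) + triangle (1 + 2 * t))      ≡⟨ cong (λ x → (2 + 2 * t) + ((1 + 2 * t) + x)) (triangle-1+2t t) ⟩
    (2 + 2 * t) + ((1 + 2 * t) + (3 * (t + triangle t) + 1 * triangle t))
                                                            ≡⟨ polynomial t (triangle t) ⟩
    3 * triangle (2 + t) + 1 * triangle (suc t)             ∎
    where
    polynomial : ∀ t u → (2 + 2 * t) + ((1 + 2 * t) + (3 * (t + u) + 1 * u)) ≡ 3 * (suc t + (t + u)) + 1 * (t + u)
    polynomial = solve-∀

  triangle-2+2t : ∀ t → triangle (2 + 2 * t) ≡ 3 * triangle (suc t) + 1 * triangle (2 + t)
  triangle-2+2t zero    = refl
  triangle-2+2t (suc t) = begin
    triangle (2 + 2 * suc t)                                ≡⟨ cong (λ x → triangle (2 + x)) (ℕ.*-suc 2 t) ⟩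
    (3 + 2 * t) + ((2 + 2 * t) + triangle (2 + 2 * t))      ≡⟨ cong (λ x → (3 + 2 * t) + ((2 + 2 * t) + x)) (triangle-2+2t t) ⟩
    (3 + 2 * t) + ((2 + 2 * t) + (3 * (t + triangle t) + 1 * (suc t + (t + triangle t))))
                                                            ≡⟨ polynomial t (triangle t) ⟩
    3 * triangle (2 + t) + 1 * triangle (3 + t)             ∎
    where
    polynomial : ∀ t u → (3 + 2 * t) + ((2 + 2 * t) + (3 * (t + u) + 1 * (suc t + (t + u))))
                         ≡ 3 * (suc t + (t + u)) + 1 * (2 + t + (suc t + (t + u)))
    polynomial = solve-∀

  triangle-1+3t : ∀ t → triangle (1 + 3 * t) ≡ 3 * (2 * triangle (suc t) + 1 * triangle t)
  triangle-1+3t zero    = refl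
  triangle-1+3t (suc t) = begin
    triangle (1 + 3 * suc t)                                           ≡⟨ cong (λ x → triangle (1 + x)) (ℕ.*-suc 3 t) ⟩
    (3 + x) + ((2 + x) + ((1 + x) + triangle (1 + x)))                 ≡⟨ cong (λ y → (3 + x) + ((2 + x) + ((1 + x) + y))) (triangle-1+3t t) ⟩
    (3 + x) + ((2 + x) + ((1 + x) + 3 * (2 * (t + triangle t) + 1 * triangle t)))
                                                                       ≡⟨ polynomial t (triangle t) ⟩
    3 * (2 * triangle (2 + t) + 1 * triangle (suc t))                 ∎
    where
    x : ℕ
    x = 3 * t
    polynomial : ∀ t u → (3 + 3 * t) + ((2 + 3 * t) + ((1 + 3 * t) + 3 * (2 * (t + u) + 1 * u)))
                         ≡ 3 * (2 * (suc t + (t + u)) + 1 * (t + u))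
    polynomial = solve-∀

  triangle-2+3t : ∀ t → triangle (2 + 3 * t) ≡ suc (3 * (3 * triangle (suc t)))
  triangle-2+3t zero    = refl
  triangle-2+3t (suc t) = begin
    triangle (2 + 3 * suc t)                                           ≡⟨ cong (λ x → triangle (2 + x)) (ℕ.*-suc 3 t) ⟩
    (4 + x) + ((3 + x) + ((2 + x) + triangle (2 + x)))                 ≡⟨ cong (λ y → (4 + x) + ((3 + x) + ((2 + x) + y))) (triangle-2+3t t) ⟩
    (4 + x) + ((3 + x) + ((2 + x) + suc (3 * (3 * (t + triangle t)))))  ≡⟨ polynomial t (triangle t) ⟩
    suc (3 * (3 * triangle (2 + t)))                                   ∎
    where
    x : ℕ
    x = 3 * t
    polynomial : ∀ t u → (4 + 3 * t) + ((3 + 3 * t) + ((2 + 3 * t) + suc (3 * (3 * (t + u)))))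
                         ≡ suc (3 * (3 * (suc t + (t + u))))
    polynomial = solve-∀

  triangle-3+3t : ∀ t → triangle (3 + 3 * t) ≡ 3 * (2 * triangle (suc t) + 1 * triangle (2 + t))
  triangle-3+3t zero    = refl
  triangle-3+3t (suc t) = begin
    triangle (3 + 3 * suc t)                                           ≡⟨ cong (λ x → triangle (3 + x)) (ℕ.*-suc 3 t) ⟩
    (5 + x) + ((4 + x) + ((3 + x) + triangle (3 + x)))                 ≡⟨ cong (λ y → (5 + x) + ((4 + x) + ((3 + x) + y))) (triangle-3+3t t) ⟩
    (5 + x) + ((4 + x) + ((3 + x) + 3 * (2 * (t + triangle t) + 1 * (suc t + (t + triangle t)))))
                                                                       ≡⟨ polynomial t (triangle t) ⟩
    3 * (2 * triangle (2 + t) + 1 * triangle (3 + t))                 ∎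
    where
    x : ℕ
    x = 3 * t
    polynomial : ∀ t u → (5 + 3 * t) + ((4 + 3 * t) + ((3 + 3 * t) + 3 * (2 * (t + u) + 1 * (suc t + (t + u)))))
                         ≡ 3 * (2 * (suc t + (t + u)) + 1 * (2 + t + (suc t + (t + u))))
    polynomial = solve-∀

module Dissection where
  open EtaProducts public
  open TriangleIdentities
  open import Data.Nat.Base using (ℕ; suc; _≤_) renaming (_+_ to _+ℕ_; _*_ to _*ℕ_)
  import Data.Nat.Properties as ℕ
  open import Relation.Binary.PropositionalEquality using (_≡_; cong)
  open Solver using (solve; _:=_; _:+_)

  ∑q^-cong : ∀ {e e′ : ℕ → ℕ} → (∀ j → e j ≡ e′ j) → ∑q^ e ≈ ∑q^ e′
  ∑q^-cong e≡e′ = ∑.cong (λ j → ≈-reflexive (cong q^_ (e≡e′ j)))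

  ∑q^-dilate : ∀ {e : ℕ → ℕ} → (∀ j → j ≤ e j) → ∑q^ (λ j → 3 *ℕ e j) ≈ dilate (∑q^ e)
  ∑q^-dilate {e} j≤e = ≈-trans (∑.cong (λ j → ≈-sym (dilate-q^ (e j)))) (∑-dilate (∑q^-summable j≤e))

  ∑q^-shift : ∀ {e : ℕ → ℕ} → (∀ j → j ≤ e j) → ∑q^ (λ j → suc (e j)) ≈ shift (∑q^ e)
  ∑q^-shift j≤e = ∑-shiftBy 1 (∑q^-summable j≤e)

  private
    residue-≤ : ∀ {e : ℕ → ℕ} p r → (∀ j → j ≤ e j) → ∀ t → t ≤ e (r +ℕ suc p *ℕ t)
    residue-≤ {e} p r j≤e t = ℕ.≤-trans (ℕ.≤-trans (ℕ.m≤n*m t (suc p)) (ℕ.m≤n+m _ r)) (j≤e (r +ℕ suc p *ℕ t))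

  ∑q^-split₂ : ∀ {e : ℕ → ℕ} → (∀ j → j ≤ e j) → ∑q^ e ≈ ∑q^ (λ t → e (2 *ℕ t)) + ∑q^ (λ t → e (1 +ℕ 2 *ℕ t))
  ∑q^-split₂ {e} j≤e = begin
    ∑q^ e
      ≈⟨ ∑.chunks 1 (∑q^-summable j≤e) ⟩
    ∑ (λ t → q^ e (2 *ℕ t) + (q^ e (1 +ℕ 2 *ℕ t) + 0#))
      ≈⟨ ∑.cong (λ t → +-cong (≈-refl {q^ e (2 *ℕ t)}) (+-identityʳ (q^ e (1 +ℕ 2 *ℕ t)))) ⟩
    ∑ (λ t → q^ e (2 *ℕ t) + q^ e (1 +ℕ 2 *ℕ t))
      ≈⟨ ≈-sym (∑.merge (∑q^-summable (residue-≤ 1 0 j≤e)) (∑q^-summable (residue-≤ 1 1 j≤e))) ⟩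
    ∑q^ (λ t → e (2 *ℕ t)) + ∑q^ (λ t → e (1 +ℕ 2 *ℕ t)) ∎
    where open ≈-Reasoning

  ∑q^-split₃ : ∀ {e : ℕ → ℕ} → (∀ j → j ≤ e j) →
    ∑q^ e ≈ ∑q^ (λ t → e (3 *ℕ t)) + (∑q^ (λ t → e (1 +ℕ 3 *ℕ t)) + ∑q^ (λ t → e (2 +ℕ 3 *ℕ t)))
  ∑q^-split₃ {e} j≤e = begin
    ∑q^ e
      ≈⟨ ∑.chunks 2 (∑q^-summable j≤e) ⟩
    ∑ (λ t → q^ e (3 *ℕ t) + (q^ e (1 +ℕ 3 *ℕ t) + (q^ e (2 +ℕ 3 *ℕ t) + 0#)))
      ≈⟨ ∑.cong (λ t → +-cong (≈-refl {q^ e (3 *ℕ t)}) (+-cong (≈-refl {q^ e (1 +ℕ 3 *ℕ t)}) (+-identityʳ (q^ e (2 +ℕ 3 *ℕ t))))) ⟩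
    ∑ (λ t → q^ e (3 *ℕ t) + (q^ e (1 +ℕ 3 *ℕ t) + q^ e (2 +ℕ 3 *ℕ t)))
      ≈⟨ ≈-sym (∑.merge (∑q^-summable (residue-≤ 2 0 j≤e))
                    (λ k → +-cong-≈[] k (∑q^-summable (residue-≤ 2 1 j≤e) k) (∑q^-summable (residue-≤ 2 2 j≤e) k))) ⟩
    ∑q^ (λ t → e (3 *ℕ t)) + ∑ (λ t → q^ e (1 +ℕ 3 *ℕ t) + q^ e (2 +ℕ 3 *ℕ t))
      ≈⟨ +-cong (≈-refl {∑q^ (λ t → e (3 *ℕ t))}) (≈-sym (∑.merge (∑q^-summable (residue-≤ 2 1 j≤e)) (∑q^-summable (residue-≤ 2 2 j≤e)))) ⟩
    ∑q^ (λ t → e (3 *ℕ t)) + (∑q^ (λ t → e (1 +ℕ 3 *ℕ t)) + ∑q^ (λ t → e (2 +ℕ 3 *ℕ t))) ∎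
    where open ≈-Reasoning

  ψ A : Series
  ψ = ∑q^ (λ j → triangle (suc j))
  A = θ 2 1

  private
    j≤triangle : ∀ j → j ≤ triangle (suc j)
    j≤triangle j = ℕ.m≤m+n j (triangle j)

  ψ≈θ : ψ ≈ θ 3 1
  ψ≈θ = ≈-trans (∑q^-split₂ j≤triangle) (+-cong (∑q^-cong triangle-1+2t) (∑q^-cong triangle-2+2t))

  ψ-dissection : ψ ≈ dilate A + shift (dilate (dilate ψ))
  ψ-dissection = begin
    ψ
      ≈⟨ ∑q^-split₃ j≤triangle ⟩
    ∑q^ (λ t → triangle (1 +ℕ 3 *ℕ t)) + (∑q^ (λ t → triangle (2 +ℕ 3 *ℕ t)) + ∑q^ (λ t → triangle (3 +ℕ 3 *ℕ t)))
      ≈⟨ +-cong (∑q^-cong triangle-1+3t) (+-cong (∑q^-cong triangle-2+3t) (∑q^-cong triangle-3+3t)) ⟩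
    ∑q^ (λ t → 3 *ℕ θ₊ t) + (∑q^ (λ t → suc (3 *ℕ (3 *ℕ triangle (suc t)))) + ∑q^ (λ t → 3 *ℕ θ₋ t))
      ≈⟨ +-cong (∑q^-dilate θ₊-≥) (+-cong (≈-trans (∑q^-shift 9T≥) (shift-cong (≈-trans (∑q^-dilate 3T≥) (dilate-cong (∑q^-dilate j≤triangle)))))
                                         (∑q^-dilate (λ t → ℕ.≤-trans (ℕ.n≤1+n t) (θ₋-≥ t)))) ⟩
    dilate (∑q^ θ₊) + (shift (dilate (dilate ψ)) + dilate (∑q^ θ₋))
      ≈⟨ solve 3 (λ a b c → a :+ (b :+ c) := (a :+ c) :+ b) ≈-refl (dilate (∑q^ θ₊)) (shift (dilate (dilate ψ))) (dilate (∑q^ θ₋)) ⟩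
    (dilate (∑q^ θ₊) + dilate (∑q^ θ₋)) + shift (dilate (dilate ψ))
      ≈⟨ +-cong (≈-sym (dilate-+ (∑q^ θ₊) (∑q^ θ₋))) (≈-refl {shift (dilate (dilate ψ))}) ⟩
    dilate A + shift (dilate (dilate ψ)) ∎
    where
    open ≈-Reasoning
    open TripleProductExponents 2 1 using (θ₊; θ₋)
    open Limit 1 0 using (θ₊-≥; θ₋-≥)
    3T≥ : ∀ t → t ≤ 3 *ℕ triangle (suc t)
    3T≥ t = ℕ.≤-trans (j≤triangle t) (ℕ.m≤n*m (triangle (suc t)) 3)
    9T≥ : ∀ t → t ≤ 3 *ℕ (3 *ℕ triangle (suc t))
    9T≥ t = ℕ.≤-trans (3T≥ t) (ℕ.m≤n*m (3 *ℕ triangle (suc t)) 3)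

module ProductForms where
  open Dissection public
  open import Data.Nat.Base using (ℕ; suc; _≤_; s≤s; _%_; _≡ᵇ_; NonZero) renaming (_+_ to _+ℕ_; _*_ to _*ℕ_)
  import Data.Nat.Properties as ℕ
  open import Data.Nat.DivMod using ([m+kn]%n≡m%n)
  open import Data.Nat.Tactic.RingSolver using (solve-∀)
  open import Data.Bool.Base using (if_then_else_)
  open import Data.Bool.ListAction using (any)
  open import Data.List.Base using (List; []; _∷_)
  open import Relation.Binary.PropositionalEquality using (_≡_; refl; sym; trans; cong)
  open Solver using (solve; _:=_; _:*_; _:+_; _:-_; con)

  1+q^≈ : ∀ e .{{_ : NonZero e}} → 1# + q^ e ≈ (1# - q^ (e +ℕ e)) * geometric e
  1+q^≈ e = begin
    1# + q^ e                                         ≈⟨ ≈-sym (*-identityʳ (1# + q^ e)) ⟩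
    (1# + q^ e) * 1#                                  ≈⟨ *-cong (≈-refl {1# + q^ e}) (≈-sym (1-q^-*-geometric e)) ⟩
    (1# + q^ e) * ((1# - q^ e) * geometric e)         ≈⟨ solve 2 (λ x g → (con 1₃ :+ x) :* ((con 1₃ :- x) :* g) := (con 1₃ :- x :* x) :* g)
                                                                 ≈-refl (q^ e) (geometric e) ⟩
    (1# - q^ e * q^ e) * geometric e                  ≈⟨ *-cong (+-cong (≈-refl {1#}) (-‿cong (q^-*-q^ e e))) (≈-refl {geometric e}) ⟩
    (1# - q^ (e +ℕ e)) * geometric e                  ∎
    where open ≈-Reasoning

  -- Each factor 1 + x of the triple product is rewritten as (1 - x²) / (1 - x).
  module ThetaFactors (α′ β′ : ℕ) where
    α β s : ℕ
    α = suc α′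
    β = suc β′
    s = α +ℕ β

    euler-part squares-part : ℕ → Series
    euler-part t   = (1# - q^ (s *ℕ suc t)) * (geometric (β +ℕ s *ℕ t) * geometric (α +ℕ s *ℕ t))
    squares-part t = (1# - q^ ((β +ℕ s *ℕ t) +ℕ (β +ℕ s *ℕ t))) * (1# - q^ ((α +ℕ s *ℕ t) +ℕ (α +ℕ s *ℕ t)))

    private
      t<β+st : ∀ c′ t → suc t ≤ suc c′ +ℕ s *ℕ t
      t<β+st c′ t = s≤s (ℕ.≤-trans (ℕ.m≤n*m t s) (ℕ.m≤n+m (s *ℕ t) c′))

    euler-part-multipliable : Multipliable euler-part
    euler-part-multipliable t = ≈[]-weaken (ℕ.n≤1+n t) (*-≈[]-1# (suc t)
      (≈[]-weaken (ℕ.m≤n*m (suc t) s) (1-q^-≈[] (s *ℕ suc t)))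
      (*-≈[]-1# (suc t) (≈[]-weaken (t<β+st β′ t) (geometric-≈[] (β +ℕ s *ℕ t)))
                        (≈[]-weaken (t<β+st α′ t) (geometric-≈[] (α +ℕ s *ℕ t)))))

    squares-part-multipliable : Multipliable squares-part
    squares-part-multipliable t = ≈[]-weaken (ℕ.n≤1+n t) (*-≈[]-1# (suc t)
      (≈[]-weaken (ℕ.≤-trans (t<β+st β′ t) (ℕ.m≤m+n _ _)) (1-q^-≈[] _))
      (≈[]-weaken (ℕ.≤-trans (t<β+st α′ t) (ℕ.m≤m+n _ _)) (1-q^-≈[] _)))

    θ-factors : θ α β ≈ ∏ euler-part * ∏ squares-part
    θ-factors = begin
      θ α β
        ≈⟨ ≈-sym (jacobi-triple-product α β) ⟩
      ∏ (λ t → 1# - q^ s ^ suc t) * ∏ pair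
        ≈⟨ ∏.merge euler-multipliable pair-multipliable ⟩
      ∏ (λ t → (1# - q^ s ^ suc t) * pair t)
        ≈⟨ ∏.cong factor ⟩
      ∏ (λ t → euler-part t * squares-part t)
        ≈⟨ ≈-sym (∏.merge euler-part-multipliable squares-part-multipliable) ⟩
      ∏ euler-part * ∏ squares-part ∎
      where
      open ≈-Reasoning
      open Limit α′ β′ using (pair; pair-multipliable; euler-multipliable)
      factor : ∀ t → (1# - q^ s ^ suc t) * pair t ≈ euler-part t * squares-part t
      factor t = ≈-trans
        (*-cong (+-cong (≈-refl {1#}) (-‿cong (q^-^ s (suc t)))) (*-cong (1+q^≈ (β +ℕ s *ℕ t)) (1+q^≈ (α +ℕ s *ℕ t))))
        (solve 5 (λ a x g y h → a :* ((x :* g) :* (y :* h)) := (a :* (g :* h)) :* (x :* y)) ≈-refl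
          (1# - q^ (s *ℕ suc t)) (1# - q^ ((β +ℕ s *ℕ t) +ℕ (β +ℕ s *ℕ t))) (geometric (β +ℕ s *ℕ t))
          (1# - q^ ((α +ℕ s *ℕ t) +ℕ (α +ℕ s *ℕ t))) (geometric (α +ℕ s *ℕ t)))

  𝟙 : (m : ℕ) .{{_ : NonZero m}} → List ℕ → ℕ → ℕ
  𝟙 m rs k = if any (k % m ≡ᵇ_) rs then 1 else 0

  𝟙-periodic : ∀ m .{{_ : NonZero m}} rs → Periodic m (𝟙 m rs)
  𝟙-periodic m rs k t = cong (λ r → if any (r ≡ᵇ_) rs then 1 else 0)
    (trans (cong (λ x → (k +ℕ x) % m) (ℕ.*-comm m t)) ([m+kn]%n≡m%n k t m))

  δ : (m : ℕ) .{{_ : NonZero m}} → ℕ → ℕ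
  δ m = 𝟙 m (0 ∷ [])

  none : ℕ → ℕ
  none _ = 0

  ψ⁺ ψ⁻ A⁺ A⁻ : ℕ → ℕ
  ψ⁺ k = 𝟙 8 (2 ∷ 6 ∷ []) k +ℕ δ 4 k
  ψ⁻   = 𝟙 4 (1 ∷ 3 ∷ [])
  A⁺ k = 𝟙 6 (2 ∷ 4 ∷ []) k +ℕ δ 3 k
  A⁻   = 𝟙 3 (1 ∷ 2 ∷ [])

  -- The normal forms of etaFactor k 0 0, etaFactor k 1 0 and etaFactor k 0 1 in solver syntax.
  private
    ⟦0,0⟧ : ∀ {n} → Solver.Polynomial n
    ⟦0,0⟧ = con 1₃ :* con 1₃
    ⟦1,0⟧ ⟦0,1⟧ : ∀ {n} → Solver.Polynomial n → Solver.Polynomial n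
    ⟦1,0⟧ x = (x :* con 1₃) :* con 1₃
    ⟦0,1⟧ x = con 1₃ :* (x :* con 1₃)

  ψ-product : ψ ≈ etaQuotient ψ⁺ ψ⁻
  ψ-product = begin
    ψ
      ≈⟨ ψ≈θ ⟩
    θ 3 1
      ≈⟨ θ-factors ⟩
    ∏ euler-part * ∏ squares-part
      ≈⟨ *-comm (∏ euler-part) (∏ squares-part) ⟩
    ∏ squares-part * ∏ euler-part
      ≈⟨ *-cong (≈-sym (etaQuotient-periodic 8 (𝟙 8 (2 ∷ 6 ∷ [])) none squares-part (𝟙-periodic 8 (2 ∷ 6 ∷ [])) (λ _ _ → refl) squares-block))
                (≈-sym (etaQuotient-periodic 4 (δ 4) (𝟙 4 (1 ∷ 3 ∷ [])) euler-part (𝟙-periodic 4 (0 ∷ [])) (𝟙-periodic 4 (1 ∷ 3 ∷ [])) euler-block)) ⟩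
    etaQuotient (𝟙 8 (2 ∷ 6 ∷ [])) none * etaQuotient (δ 4) (𝟙 4 (1 ∷ 3 ∷ []))
      ≈⟨ etaQuotient-* (𝟙 8 (2 ∷ 6 ∷ [])) none (δ 4) (𝟙 4 (1 ∷ 3 ∷ [])) ⟩
    etaQuotient ψ⁺ ψ⁻ ∎
    where
    open ≈-Reasoning
    open ThetaFactors 2 0
    euler-block : ∀ t → ∏[< 4 ] (λ r → etaFactor (suc r +ℕ 4 *ℕ t) (δ 4 (suc r)) (ψ⁻ (suc r)))
                        ≈ euler-part t
    euler-block t = ≈-trans
      (solve 3 (λ g₁ g₃ a → ⟦0,1⟧ g₁ :* (⟦0,0⟧ :* (⟦0,1⟧ g₃ :* (⟦1,0⟧ a :* con 1₃))) := a :* (g₁ :* g₃))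
        ≈-refl (geometric (1 +ℕ 4 *ℕ t)) (geometric (3 +ℕ 4 *ℕ t)) (1# - q^ (4 +ℕ 4 *ℕ t)))
      (*-cong (≈-reflexive (cong (λ k → 1# - q^ k) (sym (ℕ.*-suc 4 t)))) ≈-refl)
    squares-block : ∀ t → ∏[< 8 ] (λ r → etaFactor (suc r +ℕ 8 *ℕ t) (𝟙 8 (2 ∷ 6 ∷ []) (suc r)) 0) ≈ squares-part t
    squares-block t = ≈-trans
      (solve 2 (λ a₂ a₆ → ⟦0,0⟧ :* (⟦1,0⟧ a₂ :* (⟦0,0⟧ :* (⟦0,0⟧ :* (⟦0,0⟧ :* (⟦1,0⟧ a₆ :* (⟦0,0⟧ :* (⟦0,0⟧ :* con 1₃)))))))
                          := a₂ :* a₆)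
        ≈-refl (1# - q^ (2 +ℕ 8 *ℕ t)) (1# - q^ (6 +ℕ 8 *ℕ t)))
      (*-cong (≈-reflexive (cong (λ k → 1# - q^ k) (double 1 t))) (≈-reflexive (cong (λ k → 1# - q^ k) (double 3 t))))
      where
      double : ∀ c t → (c +ℕ c) +ℕ 8 *ℕ t ≡ (c +ℕ 4 *ℕ t) +ℕ (c +ℕ 4 *ℕ t)
      double = solve-∀

  A-product : A ≈ etaQuotient A⁺ A⁻
  A-product = begin
    A
      ≈⟨ θ-factors ⟩
    ∏ euler-part * ∏ squares-part
      ≈⟨ *-comm (∏ euler-part) (∏ squares-part) ⟩
    ∏ squares-part * ∏ euler-part
      ≈⟨ *-cong (≈-sym (etaQuotient-periodic 6 (𝟙 6 (2 ∷ 4 ∷ [])) none squares-part (𝟙-periodic 6 (2 ∷ 4 ∷ [])) (λ _ _ → refl) squares-block))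
                (≈-sym (etaQuotient-periodic 3 (δ 3) (𝟙 3 (1 ∷ 2 ∷ [])) euler-part (𝟙-periodic 3 (0 ∷ [])) (𝟙-periodic 3 (1 ∷ 2 ∷ [])) euler-block)) ⟩
    etaQuotient (𝟙 6 (2 ∷ 4 ∷ [])) none * etaQuotient (δ 3) (𝟙 3 (1 ∷ 2 ∷ []))
      ≈⟨ etaQuotient-* (𝟙 6 (2 ∷ 4 ∷ [])) none (δ 3) (𝟙 3 (1 ∷ 2 ∷ [])) ⟩
    etaQuotient A⁺ A⁻ ∎
    where
    open ≈-Reasoning
    open ThetaFactors 1 0
    euler-block : ∀ t → ∏[< 3 ] (λ r → etaFactor (suc r +ℕ 3 *ℕ t) (δ 3 (suc r)) (A⁻ (suc r)))
                        ≈ euler-part t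
    euler-block t = ≈-trans
      (solve 3 (λ g₁ g₂ a → ⟦0,1⟧ g₁ :* (⟦0,1⟧ g₂ :* (⟦1,0⟧ a :* con 1₃)) := a :* (g₁ :* g₂))
        ≈-refl (geometric (1 +ℕ 3 *ℕ t)) (geometric (2 +ℕ 3 *ℕ t)) (1# - q^ (3 +ℕ 3 *ℕ t)))
      (*-cong (≈-reflexive (cong (λ k → 1# - q^ k) (sym (ℕ.*-suc 3 t)))) ≈-refl)
    squares-block : ∀ t → ∏[< 6 ] (λ r → etaFactor (suc r +ℕ 6 *ℕ t) (𝟙 6 (2 ∷ 4 ∷ []) (suc r)) 0) ≈ squares-part t
    squares-block t = ≈-trans
      (solve 2 (λ a₂ a₄ → ⟦0,0⟧ :* (⟦1,0⟧ a₂ :* (⟦0,0⟧ :* (⟦1,0⟧ a₄ :* (⟦0,0⟧ :* (⟦0,0⟧ :* con 1₃))))) := a₂ :* a₄)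
        ≈-refl (1# - q^ (2 +ℕ 6 *ℕ t)) (1# - q^ (4 +ℕ 6 *ℕ t)))
      (*-cong (≈-reflexive (cong (λ k → 1# - q^ k) (double 1 t))) (≈-reflexive (cong (λ k → 1# - q^ k) (double 2 t))))
      where
      double : ∀ c t → (c +ℕ c) +ℕ 6 *ℕ t ≡ (c +ℕ 3 *ℕ t) +ℕ (c +ℕ 3 *ℕ t)
      double = solve-∀

module PartitionCounting where
  open import Data.Nat.Base using (ℕ; zero; suc; _+_; _*_; _∸_; _≤_; _<_; _≤ᵇ_)
  import Data.Nat.Properties as ℕ
  open import Data.Nat.ListAction using (sum)
  open import Data.List.Base using (List; _∷_; applyUpTo)
  open import Data.List.Properties using (map-upTo)
  open import Data.Bool.Base using (true; false; T; if_then_else_)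
  open import Data.Empty using (⊥-elim)
  open import Data.Unit.Base using (tt)
  open import Relation.Binary.PropositionalEquality using (_≡_; refl; sym; trans; cong; cong₂; subst; module ≡-Reasoning)
  open import Defs using (countParts)

  sum-applyUpTo-cong : ∀ {g h : ℕ → ℕ} n → (∀ m → g m ≡ h m) → sum (applyUpTo g n) ≡ sum (applyUpTo h n)
  sum-applyUpTo-cong zero    g≡h = refl
  sum-applyUpTo-cong (suc n) g≡h = cong₂ _+_ (g≡h 0) (sum-applyUpTo-cong n (λ m → g≡h (suc m)))

  sum-applyUpTo-split : ∀ (g : ℕ → ℕ) a b → sum (applyUpTo g (a + b)) ≡ sum (applyUpTo g a) + sum (applyUpTo (λ m → g (a + m)) b)
  sum-applyUpTo-split g zero    b = refl
  sum-applyUpTo-split g (suc a) b =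
    trans (cong (g 0 +_) (sum-applyUpTo-split (λ m → g (suc m)) a b)) (sym (ℕ.+-assoc (g 0) _ _))

  sum-applyUpTo-0 : ∀ (g : ℕ → ℕ) n → (∀ m → g m ≡ 0) → sum (applyUpTo g n) ≡ 0
  sum-applyUpTo-0 g zero    g≡0 = refl
  sum-applyUpTo-0 g (suc n) g≡0 = cong₂ _+_ (g≡0 0) (sum-applyUpTo-0 (λ m → g (suc m)) n (λ m → g≡0 (suc m)))

  ≤ᵇ-false : ∀ {m n} → n < m → (m ≤ᵇ n) ≡ false
  ≤ᵇ-false {m} {n} n<m with m ≤ᵇ n in eq
  ... | false = refl
  ... | true  = ⊥-elim (ℕ.<⇒≱ n<m (ℕ.≤ᵇ⇒≤ m n (subst T (sym eq) tt)))

  ≤ᵇ-≡ : ∀ {m n m′ n′} → (m ≤ n → m′ ≤ n′) → (m′ ≤ n′ → m ≤ n) → (m ≤ᵇ n) ≡ (m′ ≤ᵇ n′)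
  ≤ᵇ-≡ {m} {n} {m′} {n′} to from with m ≤ᵇ n in eq | m′ ≤ᵇ n′ in eq′
  ... | false | false = refl
  ... | true  | true  = refl
  ... | true  | false = ⊥-elim (subst T eq′ (ℕ.≤⇒≤ᵇ (to (ℕ.≤ᵇ⇒≤ m n (subst T (sym eq) tt)))))
  ... | false | true  = ⊥-elim (subst T eq (ℕ.≤⇒≤ᵇ (from (ℕ.≤ᵇ⇒≤ m′ n′ (subst T (sym eq′) tt)))))

  +-≤ᵇ-+ : ∀ t x y → (t + x ≤ᵇ t + y) ≡ (x ≤ᵇ y)
  +-≤ᵇ-+ t x y = ≤ᵇ-≡ (ℕ.+-cancelˡ-≤ t x y) (ℕ.+-monoʳ-≤ t)

  -- Partitions with parts from t ∷ ts are counted by the multiplicity m of the part t.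
  module _ (t′ : ℕ) (ts : List ℕ) where
    t : ℕ
    t = suc t′

    with-copies : ℕ → ℕ → ℕ
    with-copies N m = if m * t ≤ᵇ N then countParts (N ∸ m * t) ts else 0

    countParts-∷ : ∀ N → countParts N (t ∷ ts) ≡ sum (applyUpTo (with-copies N) (suc N))
    countParts-∷ N = cong sum (map-upTo (with-copies N) (suc N))

    with-copies-suc : ∀ N m → with-copies (t + N) (suc m) ≡ with-copies N m
    with-copies-suc N m = cong₂ (λ b k → if b then countParts k ts else 0)
      (+-≤ᵇ-+ t (m * t) N) (ℕ.[m+n]∸[m+o]≡n∸o t N (m * t))

    with-too-many-copies : ∀ N m → N < m * t → with-copies N m ≡ 0
    with-too-many-copies N m N<mt = cong (λ b → if b then countParts (N ∸ m * t) ts else 0) (≤ᵇ-false N<mt)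

    countParts-below : ∀ N → N < t → countParts N (t ∷ ts) ≡ countParts N ts
    countParts-below N N<t = begin
      countParts N (t ∷ ts)                                                  ≡⟨ countParts-∷ N ⟩
      countParts N ts + sum (applyUpTo (λ m → with-copies N (suc m)) N)      ≡⟨ cong (countParts N ts +_) none ⟩
      countParts N ts + 0                                                    ≡⟨ ℕ.+-identityʳ _ ⟩
      countParts N ts                                                        ∎
      where
      open ≡-Reasoning
      none : sum (applyUpTo (λ m → with-copies N (suc m)) N) ≡ 0
      none = sum-applyUpTo-0 _ N (λ m → with-too-many-copies N (suc m) (ℕ.<-≤-trans N<t (ℕ.m≤m+n t (m * t))))

    countParts-above : ∀ N → countParts (t + N) (t ∷ ts) ≡ countParts (t + N) ts + countParts N (t ∷ ts)
    countParts-above N = begin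
      countParts (t + N) (t ∷ ts)
        ≡⟨ countParts-∷ (t + N) ⟩
      countParts (t + N) ts + sum (applyUpTo (λ m → with-copies (t + N) (suc m)) (t + N))
        ≡⟨ cong (countParts (t + N) ts +_) (begin
          sum (applyUpTo (λ m → with-copies (t + N) (suc m)) (t + N))
            ≡⟨ sum-applyUpTo-cong (t + N) (with-copies-suc N) ⟩
          sum (applyUpTo (with-copies N) (t + N))
            ≡⟨ cong (λ k → sum (applyUpTo (with-copies N) k)) (cong suc (ℕ.+-comm t′ N)) ⟩
          sum (applyUpTo (with-copies N) (suc N + t′))
            ≡⟨ sum-applyUpTo-split (with-copies N) (suc N) t′ ⟩
          sum (applyUpTo (with-copies N) (suc N)) + sum (applyUpTo (λ m → with-copies N (suc N + m)) t′)
            ≡⟨ cong₂ _+_ (sym (countParts-∷ N)) none ⟩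
          countParts N (t ∷ ts) + 0
            ≡⟨ ℕ.+-identityʳ _ ⟩
          countParts N (t ∷ ts) ∎) ⟩
      countParts (t + N) ts + countParts N (t ∷ ts) ∎
      where
      open ≡-Reasoning
      none : sum (applyUpTo (λ m → with-copies N (suc N + m)) t′) ≡ 0
      none = sum-applyUpTo-0 _ t′ (λ m → with-too-many-copies N (suc N + m)
        (ℕ.≤-trans (ℕ.m≤m+n (suc N) m) (ℕ.m≤m*n (suc N + m) t)))

module PartitionSeries where
  open ProductForms public
  open PartitionCounting
  open import Data.Nat.Base using (ℕ; zero; suc; _∸_; s≤s; NonZero) renaming (_+_ to _+ℕ_)
  import Data.Nat.Properties as ℕ
  open import Data.List.Base using (List; []; _∷_; _++_; replicate; applyUpTo; concatMap)
  open import Data.List.Relation.Unary.All using (All; []; _∷_)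
  import Data.List.Relation.Unary.All.Properties as All
  open import Relation.Nullary.Decidable using (yes; no)
  open import Relation.Binary.PropositionalEquality using (_≡_; refl; sym; trans; cong; subst; module ≡-Reasoning)
  open import Defs using (countParts; partTypes; colours; a)
  open Solver using (solve; _:=_; _:*_; _:+_; _:-_; con)

  geometric-solves : ∀ k .{{_ : NonZero k}} {Y Z} → Z ≈ Y + shiftBy k Z → Z ≈ geometric k * Y
  geometric-solves k@(suc _) {Y} {Z} Z≈Y+qᵏZ = *-cancelˡ {U = 1# - q^ k} refl (begin
    (1# - q^ k) * Z                  ≈⟨ solve 2 (λ x z → (con 1₃ :- x) :* z := z :- x :* z) ≈-refl (q^ k) Z ⟩
    Z - q^ k * Z                     ≈⟨ +-cong Z≈Y+qᵏZ (-‿cong (q^-* k Z)) ⟩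
    Y + shiftBy k Z - shiftBy k Z    ≈⟨ solve 2 (λ y w → y :+ w :- w := y) ≈-refl Y (shiftBy k Z) ⟩
    Y                                ≈⟨ ≈-sym (*-identityˡ Y) ⟩
    1# * Y                           ≈⟨ *-cong (≈-sym (1-q^-*-geometric k)) (≈-refl {Y}) ⟩
    (1# - q^ k) * geometric k * Y    ≈⟨ *-assoc (1# - q^ k) (geometric k) Y ⟩
    (1# - q^ k) * (geometric k * Y)  ∎)
    where open ≈-Reasoning

  partitions : List ℕ → Series
  partitions ts N = reduce₃ (countParts N ts)

  partitions-∷ : ∀ t′ ts → partitions (suc t′ ∷ ts) ≈ partitions ts + shiftBy (suc t′) (partitions (suc t′ ∷ ts))
  partitions-∷ t′ ts N with suc t′ ℕ.≤? N
  ... | no  N≱t = trans (cong reduce₃ (countParts-below t′ ts N (ℕ.≰⇒> N≱t)))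
    (sym (trans (cong (partitions ts N +₃_) (shiftBy-below (suc t′) _ N (ℕ.≰⇒> N≱t))) (+₃-identityʳ _)))
  ... | yes t≤N = subst (λ M → partitions (suc t′ ∷ ts) M ≡ (partitions ts + shiftBy (suc t′) (partitions (suc t′ ∷ ts))) M)
    (ℕ.m+[n∸m]≡n t≤N) (at (N ∸ suc t′))
    where
    at : ∀ M → partitions (suc t′ ∷ ts) (suc t′ +ℕ M)
             ≡ partitions ts (suc t′ +ℕ M) +₃ shiftBy (suc t′) (partitions (suc t′ ∷ ts)) (suc t′ +ℕ M)
    at M = trans (cong reduce₃ (countParts-above t′ ts M))
      (trans (reduce₃-+ (countParts (suc t′ +ℕ M) ts) (countParts M (suc t′ ∷ ts)))
        (cong (partitions ts (suc t′ +ℕ M) +₃_) (sym (shiftBy-at (suc t′) (partitions (suc t′ ∷ ts)) M))))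

  geometrics : List ℕ → Series
  geometrics []       = 1#
  geometrics (t ∷ ts) = geometric t * geometrics ts

  partitions-geometrics : ∀ ts → All NonZero ts → partitions ts ≈ geometrics ts
  partitions-geometrics []              []       zero    = refl
  partitions-geometrics []              []       (suc N) = refl
  partitions-geometrics (suc t′ ∷ ts) (_ ∷ nz) =
    ≈-trans (geometric-solves (suc t′) (partitions-∷ t′ ts)) (*-cong (≈-refl {geometric (suc t′)}) (partitions-geometrics ts nz))

  geometrics-++ : ∀ xs ys → geometrics (xs ++ ys) ≈ geometrics xs * geometrics ys
  geometrics-++ []       ys = ≈-sym (*-identityˡ (geometrics ys))
  geometrics-++ (x ∷ xs) ys = ≈-trans (*-cong (≈-refl {geometric x}) (geometrics-++ xs ys))
    (≈-sym (*-assoc (geometric x) (geometrics xs) (geometrics ys)))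

  geometrics-replicate : ∀ c t → geometrics (replicate c t) ≈ geometric t ^ c
  geometrics-replicate zero    t = ≈-refl
  geometrics-replicate (suc c) t = *-cong (≈-refl {geometric t}) (geometrics-replicate c t)

  geometrics-concatMap : ∀ (h : ℕ → List ℕ) g n → geometrics (concatMap h (applyUpTo g n)) ≈ ∏[< n ] (λ i → geometrics (h (g i)))
  geometrics-concatMap h g zero    = ≈-refl
  geometrics-concatMap h g (suc n) = ≈-trans (geometrics-++ (h (g 0)) (concatMap h (applyUpTo (λ i → g (suc i)) n)))
    (*-cong (≈-refl {geometrics (h (g 0))}) (geometrics-concatMap h (λ i → g (suc i)) n))

  partition-series : ∀ r s N → reduce₃ (a r s N) ≡ etaQuotient none (colours r s) N
  partition-series r s N = begin
    partitions (partTypes r s N) N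
      ≡⟨ partitions-geometrics (partTypes r s N) parts-nonZero N ⟩
    geometrics (partTypes r s N) N
      ≡⟨ geometrics-concatMap parts (λ i → i) N N ⟩
    (∏[< N ] (λ i → geometrics (parts i))) N
      ≡⟨ ∏.<-cong N (λ i _ → ≈-trans (geometrics-replicate (colours r s (suc i)) (suc i)) (≈-sym (*-identityˡ _))) N ⟩
    (∏[< N ] (λ i → etaFactor (suc i) 0 (colours r s (suc i)))) N
      ≡⟨ sym (∏.≈[]-< N (suc N) (etaQuotient-multipliable none (colours r s))
               (λ k N≤k → ≈[]-weaken (s≤s N≤k) (etaFactor-≈[] (suc k) 0 (colours r s (suc k)))) N ℕ.≤-refl) ⟩
    etaQuotient none (colours r s) N ∎
    where
    open ≡-Reasoning
    parts : ℕ → List ℕ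
    parts k = replicate (colours r s (suc k)) (suc k)
    parts-nonZero : All NonZero (partTypes r s N)
    parts-nonZero = All.concat⁺ (All.map⁺ (All.applyUpTo⁺₂ (λ i → i) N (λ i → All.replicate⁺ (colours r s (suc i)) _)))

module Congruence where
  open PartitionSeries public
  open import Data.Nat.Base using (ℕ; zero; suc; _%_; _≡ᵇ_; NonZero) renaming (_+_ to _+ℕ_; _*_ to _*ℕ_)
  import Data.Nat.Properties as ℕ
  open import Data.Nat.DivMod using (m∣n⇒o%n%m≡o%m; m%n<n; n%1≡0)
  open import Data.Nat.Tactic.RingSolver using (solve-∀)
  open import Data.Bool.Base using (if_then_else_)
  open import Data.Bool.ListAction using (any)
  open import Data.Nat.Divisibility using (_∣_; divides)
  open import Data.Fin.Base using (Fin; toℕ; fromℕ<)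
  open import Data.Fin.Properties using (all?; toℕ-fromℕ<)
  open import Data.List.Base using ([]; _∷_)
  open import Data.Product.Base using (_,_)
  open import Relation.Nullary.Decidable using (True; toWitness)
  open import Relation.Binary.PropositionalEquality using (_≡_; refl; sym; trans; cong; subst; module ≡-Reasoning)
  open import Defs using (colours; a)
  open Solver using (solve; _:=_; _:*_; _:+_; _:^_; con)

  -- f m = ∏_{k ≥ 1} (1 - q^(m k))
  f : (m : ℕ) .{{_ : NonZero m}} → Series
  f m = etaQuotient (δ m) none

  -- Identities between 24-periodic exponent functions are checked on the residues 0, …, 23.
  mod-24 : ∀ m k .{{_ : NonZero m}} → m ∣ 24 → k % m ≡ k % 24 % m
  mod-24 m k m∣24 = sym (m∣n⇒o%n%m≡o%m m 24 k m∣24)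

  on-residues : ∀ (F G : ℕ → ℕ) → {True (all? (λ (r : Fin 24) → F (toℕ r) ℕ.≟ G (toℕ r)))} → ∀ k → F (k % 24) ≡ G (k % 24)
  on-residues F G {checked} k = subst (λ r → F r ≡ G r) (toℕ-fromℕ< (m%n<n k 24)) (toWitness checked (fromℕ< (m%n<n k 24)))

  ψ-exponents : ∀ k → ψ⁻ k +ℕ δ 1 k *ℕ 3 ≡ colours 2 4 k +ℕ ψ⁺ k
  ψ-exponents k rewrite mod-24 1 k (divides 24 refl) | mod-24 2 k (divides 12 refl) | mod-24 4 k (divides 6 refl)
                      | mod-24 8 k (divides 3 refl) =
    on-residues (λ k → ψ⁻ k +ℕ δ 1 k *ℕ 3) (λ k → colours 2 4 k +ℕ ψ⁺ k) k

  A*ψ-exponents : ∀ k → δ 1 k *ℕ 3 +ℕ δ 6 k +ℕ (A⁺ k +ℕ ψ⁺ k)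
                     ≡ A⁻ k +ℕ ψ⁻ k +ℕ (δ 3 k +ℕ δ 2 k *ℕ 3 +ℕ (δ 1 k +ℕ δ 3 k))
  A*ψ-exponents k rewrite mod-24 1 k (divides 24 refl) | mod-24 2 k (divides 12 refl) | mod-24 3 k (divides 8 refl)
                       | mod-24 4 k (divides 6 refl) | mod-24 6 k (divides 4 refl) | mod-24 8 k (divides 3 refl) =
    on-residues (λ k → δ 1 k *ℕ 3 +ℕ δ 6 k +ℕ (A⁺ k +ℕ ψ⁺ k))
                (λ k → A⁻ k +ℕ ψ⁻ k +ℕ (δ 3 k +ℕ δ 2 k *ℕ 3 +ℕ (δ 1 k +ℕ δ 3 k))) k

  δ-1 : ∀ k → δ 1 k ≡ 1
  δ-1 k = cong (λ r → if any (r ≡ᵇ_) (0 ∷ []) then 1 else 0) (n%1≡0 k)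

  𝟙-+ : ∀ m .{{_ : NonZero m}} rs {j} k → j ≡ k +ℕ m → 𝟙 m rs j ≡ 𝟙 m rs k
  𝟙-+ m rs k refl = trans (cong (λ x → 𝟙 m rs (k +ℕ x)) (sym (ℕ.*-identityʳ m))) (𝟙-periodic m rs k 1)

  f₃-dilates : δ 3 Dilates δ 1
  f₃-dilates t = 𝟙-periodic 3 (0 ∷ []) 1 t , 𝟙-periodic 3 (0 ∷ []) 2 t , trans (𝟙-periodic 3 (0 ∷ []) 3 t) (sym (δ-1 (suc t)))

  f₆-dilates : δ 6 Dilates δ 2
  f₆-dilates zero          = refl , refl , refl
  f₆-dilates (suc zero)    = refl , refl , refl
  f₆-dilates (suc (suc t)) with f₆-dilates t
  ... | at-1 , at-2 , at-3 =
    trans (𝟙-+ 6 (0 ∷ []) (1 +ℕ 3 *ℕ t) (index 1 t)) at-1 ,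
    trans (𝟙-+ 6 (0 ∷ []) (2 +ℕ 3 *ℕ t) (index 2 t)) at-2 ,
    trans (𝟙-+ 6 (0 ∷ []) (3 +ℕ 3 *ℕ t) (index 3 t)) (trans at-3 (sym (𝟙-+ 2 (0 ∷ []) (suc t) (ℕ.+-comm 2 (suc t)))))
    where
    index : ∀ r t → r +ℕ 3 *ℕ suc (suc t) ≡ (r +ℕ 3 *ℕ t) +ℕ 6
    index = solve-∀

  dilate-f₁ : dilate (f 1) ≈ f 3
  dilate-f₁ = etaQuotient-dilate {δ 1} {none} {δ 3} {none} f₃-dilates (λ _ → refl , refl , refl)

  dilate-f₂ : dilate (f 2) ≈ f 6
  dilate-f₂ = etaQuotient-dilate {δ 2} {none} {δ 6} {none} f₆-dilates (λ _ → refl , refl , refl)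

  dilate-f : ∀ m .{{_ : NonZero m}} → dilate (f m) ≈ etaQuotient (λ k → δ m k *ℕ 3) none
  dilate-f m = ≈-sym (etaQuotient-frobenius (δ m) none)

  P : Series
  P n = reduce₃ (a 2 4 n)

  P-f₃ : P * dilate (f 1) ≈ ψ
  P-f₃ = begin
    P * dilate (f 1)
      ≈⟨ *-comm P (dilate (f 1)) ⟩
    dilate (f 1) * P
      ≈⟨ *-cong (dilate-f 1) (partition-series 2 4) ⟩
    etaQuotient (λ k → δ 1 k *ℕ 3) none * etaQuotient none (colours 2 4)
      ≈⟨ etaQuotient-* (λ k → δ 1 k *ℕ 3) none none (colours 2 4) ⟩
    etaQuotient (λ k → δ 1 k *ℕ 3 +ℕ 0) (colours 2 4)
      ≈⟨ etaQuotient-cong (λ k → δ 1 k *ℕ 3 +ℕ 0) (colours 2 4) ψ⁺ ψ⁻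
           (λ k → trans (cong (ψ⁻ (suc k) +ℕ_) (ℕ.+-identityʳ _)) (ψ-exponents (suc k))) ⟩
    etaQuotient ψ⁺ ψ⁻
      ≈⟨ ≈-sym ψ-product ⟩
    ψ ∎
    where open ≈-Reasoning

  U₃-ψ : U₃ ψ ≈ A
  U₃-ψ = ≈-trans (U₃-cong ψ-dissection)
    (≈-trans (+-cong (U₃-dilate A) (U₃-shift-dilate (dilate ψ))) (+-identityʳ A))

  U₃-ψ² : U₃ (ψ * ψ) ≈ A * A
  U₃-ψ² = begin
    U₃ (ψ * ψ)
      ≈⟨ U₃-cong (*-cong ψ≈ ψ≈) ⟩
    U₃ ((dilate A + q^ 1 * dilate B) * (dilate A + q^ 1 * dilate B))
      ≈⟨ U₃-cong (solve 3 (λ x q y → (x :+ q :* y) :* (x :+ q :* y) := x :* x :+ (q :* (con 2₃ :* x :* y) :+ q :* (q :* (y :* y))))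
                        ≈-refl (dilate A) (q^ 1) (dilate B)) ⟩
    U₃ (dilate A * dilate A + (q^ 1 * (con₂ * dilate A * dilate B) + q^ 1 * (q^ 1 * (dilate B * dilate B))))
      ≈⟨ U₃-cong (+-cong (≈-sym (dilate-* A A)) (+-cong (q^-* 1 _) (≈-trans (q^-* 1 _) (shift-cong (q^-* 1 _))))) ⟩
    U₃ (dilate (A * A) + (shift (con₂ * dilate A * dilate B) + shift (shift (dilate B * dilate B))))
      ≈⟨ U₃-cong (+-cong (≈-refl {dilate (A * A)}) (+-cong (shift-cong middle) (shift-cong (shift-cong (≈-sym (dilate-* B B)))))) ⟩
    U₃ (dilate (A * A) + (shift (dilate (con₂ * A * B)) + shift (shift (dilate (B * B)))))
      ≈⟨ +-cong (U₃-dilate (A * A)) (+-cong (U₃-shift-dilate _) (U₃-shift²-dilate _)) ⟩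
    A * A + (0# + 0#)
      ≈⟨ +-identityʳ (A * A) ⟩
    A * A ∎
    where
    open ≈-Reasoning
    B con₂ : Series
    B = dilate ψ
    con₂ = const 2₃
    ψ≈ : ψ ≈ dilate A + q^ 1 * dilate B
    ψ≈ = ≈-trans ψ-dissection (+-cong (≈-refl {dilate A}) (≈-sym (q^-* 1 (dilate B))))
    middle : con₂ * dilate A * dilate B ≈ dilate (con₂ * A * B)
    middle = ≈-sym (≈-trans (dilate-* (con₂ * A) B)
      (*-cong (≈-trans (dilate-* con₂ A) (*-cong (dilate-const 2₃) (≈-refl {dilate A}))) (≈-refl {dilate B})))

  f₁-U₃P : f 1 * U₃ P ≈ A
  f₁-U₃P = ≈-trans (≈-sym (U₃-dilate-* (f 1) P)) (≈-trans (U₃-cong (≈-trans (*-comm (dilate (f 1)) P) P-f₃)) U₃-ψ)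

  -- Both sides are multiplied by f₃ f₆, written once as f₁³ f₆ and once as f₃ f₂³, to make the
  -- exponents agree exactly.
  A*ψ : A * ψ ≈ f 1 * dilate (f 1)
  A*ψ = *-cancelˡ {U = U} refl (begin
    U * (A * ψ)
      ≈⟨ *-cong (*-cong (dilate-f 1) dilate-f₂) (*-cong A-product ψ-product) ⟩
    etaQuotient (λ k → δ 1 k *ℕ 3) none * f 6 * (etaQuotient A⁺ A⁻ * etaQuotient ψ⁺ ψ⁻)
      ≈⟨ *-cong (etaQuotient-* (λ k → δ 1 k *ℕ 3) none (δ 6) none) (etaQuotient-* A⁺ A⁻ ψ⁺ ψ⁻) ⟩
    etaQuotient (λ k → δ 1 k *ℕ 3 +ℕ δ 6 k) none * etaQuotient (λ k → A⁺ k +ℕ ψ⁺ k) (λ k → A⁻ k +ℕ ψ⁻ k)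
      ≈⟨ etaQuotient-* (λ k → δ 1 k *ℕ 3 +ℕ δ 6 k) none (λ k → A⁺ k +ℕ ψ⁺ k) (λ k → A⁻ k +ℕ ψ⁻ k) ⟩
    etaQuotient (λ k → δ 1 k *ℕ 3 +ℕ δ 6 k +ℕ (A⁺ k +ℕ ψ⁺ k)) (λ k → A⁻ k +ℕ ψ⁻ k)
      ≈⟨ etaQuotient-cong (λ k → δ 1 k *ℕ 3 +ℕ δ 6 k +ℕ (A⁺ k +ℕ ψ⁺ k)) (λ k → A⁻ k +ℕ ψ⁻ k)
                          (λ k → δ 3 k +ℕ δ 2 k *ℕ 3 +ℕ (δ 1 k +ℕ δ 3 k)) none (λ k → A*ψ-exponents (suc k)) ⟩
    etaQuotient (λ k → δ 3 k +ℕ δ 2 k *ℕ 3 +ℕ (δ 1 k +ℕ δ 3 k)) none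
      ≈⟨ ≈-sym (etaQuotient-* (λ k → δ 3 k +ℕ δ 2 k *ℕ 3) none (λ k → δ 1 k +ℕ δ 3 k) none) ⟩
    etaQuotient (λ k → δ 3 k +ℕ δ 2 k *ℕ 3) none * etaQuotient (λ k → δ 1 k +ℕ δ 3 k) none
      ≈⟨ ≈-sym (*-cong (etaQuotient-* (δ 3) none (λ k → δ 2 k *ℕ 3) none) (etaQuotient-* (δ 1) none (δ 3) none)) ⟩
    f 3 * etaQuotient (λ k → δ 2 k *ℕ 3) none * (f 1 * f 3)
      ≈⟨ ≈-sym (*-cong (*-cong dilate-f₁ (dilate-f 2)) (*-cong (≈-refl {f 1}) dilate-f₁)) ⟩
    U * (f 1 * dilate (f 1)) ∎)
    where
    open ≈-Reasoning
    U : Series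
    U = dilate (f 1) * dilate (f 2)

  U₃P-ψ : U₃ P * ψ ≈ dilate (f 1)
  U₃P-ψ = *-cancelˡ {U = f 1} refl
    (≈-trans (≈-sym (*-assoc (f 1) (U₃ P) ψ)) (≈-trans (*-cong f₁-U₃P (≈-refl {ψ})) A*ψ))

  ψ-U₃²P : ψ * U₃ (U₃ P) ≈ f 1 * (A * A)
  ψ-U₃²P = begin
    ψ * U₃ (U₃ P)                   ≈⟨ ≈-sym (U₃-dilate-* ψ (U₃ P)) ⟩
    U₃ (dilate ψ * U₃ P)            ≈⟨ U₃-cong (*-cong (≈-sym (frobenius ψ)) (≈-refl {U₃ P})) ⟩
    U₃ (ψ ^ 3 * U₃ P)               ≈⟨ U₃-cong (solve 2 (λ p g → p :^ 3 :* g := (g :* p) :* (p :* p)) ≈-refl ψ (U₃ P)) ⟩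
    U₃ ((U₃ P * ψ) * (ψ * ψ))       ≈⟨ U₃-cong (*-cong U₃P-ψ (≈-refl {ψ * ψ})) ⟩
    U₃ (dilate (f 1) * (ψ * ψ))     ≈⟨ U₃-dilate-* (f 1) (ψ * ψ) ⟩
    f 1 * U₃ (ψ * ψ)                ≈⟨ *-cong (≈-refl {f 1}) U₃-ψ² ⟩
    f 1 * (A * A)                   ∎
    where open ≈-Reasoning

  f₃-U₃²P : dilate (f 1) * U₃ (U₃ P) ≈ dilate A
  f₃-U₃²P = *-cancelˡ {U = f 1} refl (begin
    f 1 * (dilate (f 1) * U₃ (U₃ P))   ≈⟨ ≈-sym (*-assoc (f 1) (dilate (f 1)) (U₃ (U₃ P))) ⟩
    (f 1 * dilate (f 1)) * U₃ (U₃ P)   ≈⟨ *-cong (≈-sym A*ψ) (≈-refl {U₃ (U₃ P)}) ⟩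
    (A * ψ) * U₃ (U₃ P)                ≈⟨ *-assoc A ψ (U₃ (U₃ P)) ⟩
    A * (ψ * U₃ (U₃ P))                ≈⟨ *-cong (≈-refl {A}) ψ-U₃²P ⟩
    A * (f 1 * (A * A))                ≈⟨ solve 2 (λ a f → a :* (f :* (a :* a)) := f :* a :^ 3) ≈-refl A (f 1) ⟩
    f 1 * A ^ 3                        ≈⟨ *-cong (≈-refl {f 1}) (frobenius A) ⟩
    f 1 * dilate A                     ∎)
    where open ≈-Reasoning

  U₃³P≈U₃P : U₃ (U₃ (U₃ P)) ≈ U₃ P
  U₃³P≈U₃P = *-cancelˡ {U = f 1} refl
    (≈-trans (≈-sym (U₃-dilate-* (f 1) (U₃ (U₃ P)))) (≈-trans (U₃-cong f₃-U₃²P) (≈-trans (U₃-dilate A) (≈-sym f₁-U₃P))))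


open import Data.Nat.Base using (_*_; _%_)
open import Data.Nat.Tactic.RingSolver using (solve-∀)
open import Relation.Binary.PropositionalEquality using (_≡_; cong; sym; module ≡-Reasoning)
open import Defs using (a)
open Congruence using (P; U₃; U₃³P≈U₃P; toℕ₃; %3≡toℕ₃∘reduce₃)

theorem1p8 : (n : ℕ) → a 2 4 (27 * n) % 3 ≡ a 2 4 (3 * n) % 3
theorem1p8 n = begin
  a 2 4 (27 * n) % 3               ≡⟨ cong (λ m → a 2 4 m % 3) (27n≡3[3[3n]] n) ⟩
  a 2 4 (3 * (3 * (3 * n))) % 3    ≡⟨ %3≡toℕ₃∘reduce₃ (a 2 4 (3 * (3 * (3 * n)))) ⟩
  toℕ₃ (U₃ (U₃ (U₃ P)) n)          ≡⟨ cong toℕ₃ (U₃³P≈U₃P n) ⟩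
  toℕ₃ (U₃ P n)                    ≡⟨ sym (%3≡toℕ₃∘reduce₃ (a 2 4 (3 * n))) ⟩
  a 2 4 (3 * n) % 3                ∎
  where
  open ≡-Reasoning
  27n≡3[3[3n]] : ∀ n → 27 * n ≡ 3 * (3 * (3 * n))
  27n≡3[3[3n]] = solve-∀
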